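{- Let $G$ be a graph with a cut-edge $e$. Then $\eta_{\mathcal{H}}(G)=\eta_{\mathcal{H}}(G/e)$.
   Context: A cut-edge is an edge whose removal increases the number of connected components. For an edge $e=uv$, $G/e$ is obtained by replacing $u$ and $v$ by a single new vertex adjacent to all vertices other than $u,v$ that were adjacent to $u$ or $v$. Graphs are finite, simple and undirected. Fix an orientation of every edge (tail $e^-$, head $e^+$) and a cyclic orientation of every triangle. $\mathcal{B}$ is the $|E|\times|V|$ matrix with $b_{ev}=-1$ if $v=e^-$, $1$ if $v=e^+$, $0$ otherwise; $\mathcal{C}$ is the $|T|\times|E|$ matrix ($T$ the set of triangles) with $c_{\vartriangle e}=\pm1$ if $e$ is an edge of $\vartriangle$ (sign $+$ iff the orientation of $e$ agrees with that of $\vartriangle$) and $0$ otherwise. The Helmholtzian matrix is $\mathcal{H}(G)=\mathcal{B}\mathcal{B}^{\intercal}+\mathcal{C}^{\intercal}\mathcal{C}$, and $\eta_{\mathcal{H}}(G)$ is the multiplicity of $0$ as an eigenvalue of $\mathcal{H}(G)$ (independent of orientations; $0$ for an edgeless graph). -}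

module Defs where

open import Data.Nat as ℕ using (ℕ; zero; suc)
open import Data.Bool using (Bool; true; false; _∧_; _∨_; not)
open import Data.Bool.Properties using () renaming (_≟_ to _≟ᵇ_)
open import Data.Fin using (Fin; zero; suc; _<_; punchIn)
open import Data.Fin.Properties using (_≟_; _<?_)
open import Data.Product using (Σ; _×_; _,_; ∃)
open import Data.Rational using (ℚ; 0ℚ; 1ℚ; _+_; _*_; -_)
open import Relation.Nullary using (Dec; yes; no; ¬_)
open import Relation.Nullary.Decidable using (isYes; _×-dec_)
open import Relation.Binary.PropositionalEquality using (_≡_)

-- A graph is given by a raw Boolean relation; the (simple, undirected)
-- adjacency is its symmetrisation with loops removed.  Every finite
-- simple graph on n labelled vertices arises this way.

Graph : ℕ → Set
Graph n = Fin n → Fin n → Bool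

adj : ∀ {n} → Graph n → Fin n → Fin n → Bool
adj G i j = not (isYes (i ≟ j)) ∧ (G i j ∨ G j i)

-- Edges: unordered pairs {i,j}, represented with i < j.
-- Fixed orientation: tail i, head j.
IsEdge : ∀ {n} → Graph n → Fin n → Fin n → Set
IsEdge G i j = (i < j) × (adj G i j ≡ true)

isEdge? : ∀ {n} (G : Graph n) (i j : Fin n) → Dec (IsEdge G i j)
isEdge? G i j = (i <? j) ×-dec (adj G i j ≟ᵇ true)

Edge : ∀ {n} → Graph n → Set
Edge {n} G = Σ (Fin n × Fin n) λ { (i , j) → IsEdge G i j }

-- Triangles {a,b,c} with a < b < c; fixed cyclic orientation a→b→c→a.
IsTri : ∀ {n} → Graph n → Fin n → Fin n → Fin n → Set
IsTri G a b c = IsEdge G a b × IsEdge G b c × IsEdge G a c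

isTri? : ∀ {n} (G : Graph n) (a b c : Fin n) → Dec (IsTri G a b c)
isTri? G a b c = isEdge? G a b ×-dec (isEdge? G b c ×-dec isEdge? G a c)

Tri : ∀ {n} → Graph n → Set
Tri {n} G = Σ (Fin n × Fin n × Fin n) λ { (a , b , c) → IsTri G a b c }

sumFin : ∀ {n} → (Fin n → ℚ) → ℚ
sumFin {zero}  f = 0ℚ
sumFin {suc n} f = f zero + sumFin (λ i → f (suc i))

sumIf : {P : Set} → Dec P → (P → ℚ) → ℚ
sumIf (yes p) f = f p
sumIf (no _)  f = 0ℚ

sumE : ∀ {n} (G : Graph n) → (Edge G → ℚ) → ℚ
sumE G f = sumFin λ i → sumFin λ j → sumIf (isEdge? G i j) λ p → f ((i , j) , p)

sumT : ∀ {n} (G : Graph n) → (Tri G → ℚ) → ℚ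
sumT G f = sumFin λ a → sumFin λ b → sumFin λ c →
  sumIf (isTri? G a b c) λ p → f ((a , b , c) , p)

ite : {P : Set} → Dec P → ℚ → ℚ → ℚ
ite (yes _) x y = x
ite (no _)  x y = y

B : ∀ {n} (G : Graph n) → Edge G → Fin n → ℚ
B G ((i , j) , _) w = ite (w ≟ i) (- 1ℚ) (ite (w ≟ j) 1ℚ 0ℚ)

C : ∀ {n} (G : Graph n) → Tri G → Edge G → ℚ
C G ((a , b , c) , _) ((i , j) , _) =
  ite ((i ≟ a) ×-dec (j ≟ b)) 1ℚ
   (ite ((i ≟ b) ×-dec (j ≟ c)) 1ℚ
    (ite ((i ≟ a) ×-dec (j ≟ c)) (- 1ℚ) 0ℚ))

-- H = B Bᵀ + Cᵀ C  (|E| × |E|)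
H : ∀ {n} (G : Graph n) → Edge G → Edge G → ℚ
H G e f = sumFin (λ w → B G e w * B G f w) + sumT G (λ t → C G t e * C G t f)

applyH : ∀ {n} (G : Graph n) → (Edge G → ℚ) → Edge G → ℚ
applyH G x e = sumE G (λ f → H G e f * x f)

InKernel : ∀ {n} (G : Graph n) → (Edge G → ℚ) → Set
InKernel G x = ∀ e → applyH G x e ≡ 0ℚ

LinIndep : ∀ {n} (G : Graph n) {k : ℕ} → (Fin k → Edge G → ℚ) → Set
LinIndep G {k} v =
  ∀ (a : Fin k → ℚ) → (∀ e → sumFin (λ l → a l * v l e) ≡ 0ℚ) → ∀ l → a l ≡ 0ℚ

-- η_H(G) = k : the null space of H(G) has dimension exactly k
-- (for the real symmetric matrix H(G) this is the multiplicity of the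
-- eigenvalue 0; H(G) has integer entries so the dimension may be
-- computed over ℚ).
EtaH : ∀ {n} (G : Graph n) → ℕ → Set
EtaH G k =
  (Σ (Fin k → Edge G → ℚ) λ v → (∀ l → InKernel G (v l)) × LinIndep G v)
  × (∀ (v : Fin (suc k) → Edge G → ℚ) → (∀ l → InKernel G (v l)) → ¬ LinIndep G v)

anyFin : ∀ {n} → (Fin n → Bool) → Bool
anyFin {zero}  f = false
anyFin {suc n} f = f zero ∨ anyFin (λ i → f (suc i))

allFin : ∀ {n} → (Fin n → Bool) → Bool
allFin {zero}  f = true
allFin {suc n} f = f zero ∧ allFin (λ i → f (suc i))

countFin : ∀ {n} → (Fin n → Bool) → ℕ
countFin {zero}  f = 0
countFin {suc n} f = (if f zero then 1 else 0) ℕ.+ countFin (λ i → f (suc i))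
  where open import Data.Bool using (if_then_else_)

reachK : ∀ {n} → Graph n → ℕ → Fin n → Fin n → Bool
reachK G zero    i j = isYes (i ≟ j)
reachK G (suc k) i j = reachK G k i j ∨ anyFin (λ w → reachK G k i w ∧ adj G w j)

reach : ∀ {n} → Graph n → Fin n → Fin n → Bool
reach {n} G = reachK G n

-- number of connected components = number of vertices that are the
-- least vertex of their component
components : ∀ {n} → Graph n → ℕ
components G = countFin λ w → allFin λ u → not (isYes (u <? w)) ∨ not (reach G u w)

deleteEdge : ∀ {n} (G : Graph n) → Edge G → Graph n
deleteEdge G ((u , v) , _) i j =
  G i j ∧ not ((isYes (i ≟ u) ∧ isYes (j ≟ v)) ∨ (isYes (i ≟ v) ∧ isYes (j ≟ u)))

IsCutEdge : ∀ {n} (G : Graph n) → Edge G → Set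
IsCutEdge G e = components G ℕ.< components (deleteEdge G e)

-- G / e for e = uv: vertex v is deleted (remaining vertices are
-- relabelled by punchIn v), and u becomes the merged vertex, adjacent to
-- every other vertex adjacent to u or v.
contract : ∀ {m} (G : Graph (suc m)) → Edge G → Graph m
contract G ((u , v) , _) a b = go (isYes (x ≟ u)) (isYes (y ≟ u))
  where
  x = punchIn v a
  y = punchIn v b
  go : Bool → Bool → Bool
  go true  _     = adj G u y ∨ adj G v y
  go false true  = adj G x u ∨ adj G x v
  go false false = adj G x y

{-# OPTIONS --safe #-}
-- Since H = BBᵀ + CᵀC is positive semidefinite, x lies in its kernel iff Bᵀx = 0 and Cx = 0; extending x
-- skew-symmetrically to ordered pairs of vertices, this says that x is a divergence-free and curl-free
-- (harmonic) flow.  If uv is a cut edge, it is the only edge leaving the component S of u in G − uv, so u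
-- and v have no common neighbour, and summing the divergence over S shows that a harmonic flow vanishes
-- on uv.  Pushing flows forward to G/uv (adding the values through u and v) and pulling flows on G/uv
-- back along the quotient map (restricted to the edges of G) are linear maps that preserve harmonicity
-- and are mutually inverse on harmonic flows, the only value lost being the one on uv.  Hence the two
-- kernels have the same dimension.
module Submission where

open import Defs
open import Function.Bundles using (_⇔_; mk⇔)
open import Data.Nat as ℕ using (ℕ; zero; suc)
open import Function using (id; _∘_; case_of_)
open import Data.Bool using (Bool; true; false; _∧_; _∨_; not)
import Data.Bool.Properties as Bool
open import Data.Fin as Fin using (Fin; zero; suc; punchIn; punchOut)
import Data.Fin.Properties as FinP
open import Data.Fin.Properties using (_≟_; _<?_)
open import Axiom.UniquenessOfIdentityProofs using (module Decidable⇒UIP)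
open import Data.Empty using (⊥)
open import Data.Product using (Σ; ∃; ∃₂; _×_; _,_; proj₁; proj₂; swap; curry)
open import Data.Sum using (_⊎_; inj₁; inj₂)
open import Data.Rational using (ℚ; 0ℚ; 1ℚ; ½; _+_; _*_; -_; _≤_; _<_; positive; negative)
open import Data.Rational.Properties hiding (_≟_; _<?_)
import Data.Rational.Properties as ℚ
open import Data.Rational.Solver using (module +-*-Solver)
open import Relation.Binary using (tri<; tri≈; tri>)
open import Relation.Binary.PropositionalEquality
open import Relation.Nullary using (Dec; yes; no; ¬_; contradiction)
open import Relation.Nullary.Decidable using (_×-dec_; isYes)
import Data.Nat.Properties as ℕP
open +-*-Solver

square-pos : ∀ q → q ≢ 0ℚ → 0ℚ < q * q
square-pos q q≢0 with <-cmp q 0ℚ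
... | tri< q<0 _ _ = let instance _ = negative q<0 in positive⁻¹ (q * q) {{neg*neg⇒pos q q}}
... | tri≈ _ q≡0 _ = contradiction q≡0 q≢0
... | tri> _ _ q>0 = let instance _ = positive q>0 in positive⁻¹ (q * q) {{pos*pos⇒pos q q}}

square-nonneg : ∀ q → 0ℚ ≤ q * q
square-nonneg q with q ℚ.≟ 0ℚ
... | yes refl = ≤-refl
... | no q≢0   = <⇒≤ (square-pos q q≢0)

square≡0⇒≡0 : ∀ q → q * q ≡ 0ℚ → q ≡ 0ℚ
square≡0⇒≡0 q q²≡0 with q ℚ.≟ 0ℚ
... | yes q≡0 = q≡0
... | no q≢0  = contradiction (sym q²≡0) (<⇒≢ (square-pos q q≢0))

nonneg+nonneg≡0 : ∀ {p q} → 0ℚ ≤ p → 0ℚ ≤ q → p + q ≡ 0ℚ → p ≡ 0ℚ × q ≡ 0ℚ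
nonneg+nonneg≡0 {p} {q} 0≤p 0≤q p+q≡0 =
  ≤-antisym (subst (p ≤_) p+q≡0 (p≤p+q 0≤q)) 0≤p ,
  ≤-antisym (subst (q ≤_) (trans (+-comm q p) p+q≡0) (p≤p+q 0≤p)) 0≤q
  where
  p≤p+q : ∀ {p q} → 0ℚ ≤ q → p ≤ p + q
  p≤p+q {p} {q} 0≤q = subst (_≤ p + q) (+-identityʳ p) (+-monoʳ-≤ p 0≤q)

record Summation {A : Set} (S : (A → ℚ) → ℚ) : Set where
  field
    sum-cong       : ∀ {f g} → (∀ a → f a ≡ g a) → S f ≡ S g
    sum-+          : ∀ f g → S (λ a → f a + g a) ≡ S f + S g
    sum-*          : ∀ c f → S (λ a → c * f a) ≡ c * S f
    sum-nonneg     : ∀ f → (∀ a → 0ℚ ≤ f a) → 0ℚ ≤ S f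
    sum-nonneg-≡0  : ∀ f → (∀ a → 0ℚ ≤ f a) → S f ≡ 0ℚ → ∀ a → f a ≡ 0ℚ
open Summation public

module _ {A : Set} {S : (A → ℚ) → ℚ} (Σ-S : Summation S) where

  sum-0 : S (λ _ → 0ℚ) ≡ 0ℚ
  sum-0 = begin
    S (λ _ → 0ℚ)        ≡⟨ sum-cong Σ-S (λ _ → sym (*-zeroˡ 0ℚ)) ⟩
    S (λ _ → 0ℚ * 0ℚ)   ≡⟨ sum-* Σ-S 0ℚ (λ _ → 0ℚ) ⟩
    0ℚ * S (λ _ → 0ℚ)   ≡⟨ *-zeroˡ (S (λ _ → 0ℚ)) ⟩
    0ℚ                  ∎
    where open ≡-Reasoning

  sum-≡0 : ∀ {f} → (∀ a → f a ≡ 0ℚ) → S f ≡ 0ℚ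
  sum-≡0 f≡0 = trans (sum-cong Σ-S f≡0) sum-0

  sum-neg : ∀ f → S (λ a → - f a) ≡ - S f
  sum-neg f = begin
    S (λ a → - f a)        ≡⟨ sum-cong Σ-S (λ a → neg≡-1* (f a)) ⟩
    S (λ a → - 1ℚ * f a)   ≡⟨ sum-* Σ-S (- 1ℚ) f ⟩
    - 1ℚ * S f             ≡⟨ neg≡-1* (S f) ⟨
    - S f                  ∎
    where
    open ≡-Reasoning
    neg≡-1* : ∀ q → - q ≡ - 1ℚ * q
    neg≡-1* = solve 1 (λ q → :- q := (:- con 1ℚ) :* q) refl

  sum-*ʳ : ∀ c f → S (λ a → f a * c) ≡ S f * c
  sum-*ʳ c f = trans (sum-cong Σ-S (λ a → *-comm (f a) c)) (trans (sum-* Σ-S c f) (*-comm c _))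

Interchangeable : {A : Set} → ((A → ℚ) → ℚ) → Set₁
Interchangeable {A} S = ∀ {B : Set} {T : (B → ℚ) → ℚ} → Summation T → ∀ (f : A → B → ℚ) →
  S (λ a → T (f a)) ≡ T (λ b → S (λ a → f a b))

sumFin-summation : ∀ {n} → Summation (sumFin {n})
sumFin-summation = record
  { sum-cong = sumFin-cong ; sum-+ = sumFin-+ ; sum-* = sumFin-*
  ; sum-nonneg = sumFin-nonneg ; sum-nonneg-≡0 = sumFin-nonneg-≡0 }
  where
  sumFin-cong : ∀ {n} {f g : Fin n → ℚ} → (∀ i → f i ≡ g i) → sumFin f ≡ sumFin g
  sumFin-cong {zero}  f≡g = refl
  sumFin-cong {suc n} f≡g = cong₂ _+_ (f≡g zero) (sumFin-cong (f≡g ∘ suc))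
  sumFin-+ : ∀ {n} (f g : Fin n → ℚ) → sumFin (λ i → f i + g i) ≡ sumFin f + sumFin g
  sumFin-+ {zero}  f g = refl
  sumFin-+ {suc n} f g = trans (cong (f zero + g zero +_) (sumFin-+ (f ∘ suc) (g ∘ suc)))
    (solve 4 (λ x y z w → (x :+ y) :+ (z :+ w) := (x :+ z) :+ (y :+ w)) refl
      (f zero) (g zero) (sumFin (f ∘ suc)) (sumFin (g ∘ suc)))
  sumFin-* : ∀ {n} c (f : Fin n → ℚ) → sumFin (λ i → c * f i) ≡ c * sumFin f
  sumFin-* {zero}  c f = sym (*-zeroʳ c)
  sumFin-* {suc n} c f = trans (cong (c * f zero +_) (sumFin-* c (f ∘ suc))) (sym (*-distribˡ-+ c _ _))
  sumFin-nonneg : ∀ {n} (f : Fin n → ℚ) → (∀ i → 0ℚ ≤ f i) → 0ℚ ≤ sumFin f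
  sumFin-nonneg {zero}  f 0≤f = ≤-refl
  sumFin-nonneg {suc n} f 0≤f = +-mono-≤ (0≤f zero) (sumFin-nonneg (f ∘ suc) (0≤f ∘ suc))
  sumFin-nonneg-≡0 : ∀ {n} (f : Fin n → ℚ) → (∀ i → 0ℚ ≤ f i) → sumFin f ≡ 0ℚ → ∀ i → f i ≡ 0ℚ
  sumFin-nonneg-≡0 {suc n} f 0≤f Σf≡0 i
    with nonneg+nonneg≡0 (0≤f zero) (sumFin-nonneg (f ∘ suc) (0≤f ∘ suc)) Σf≡0
  sumFin-nonneg-≡0 {suc n} f 0≤f Σf≡0 zero    | f0≡0 , _   = f0≡0
  sumFin-nonneg-≡0 {suc n} f 0≤f Σf≡0 (suc i) | _ , rest≡0 =
    sumFin-nonneg-≡0 (f ∘ suc) (0≤f ∘ suc) rest≡0 i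

sumFin-interchangeable : ∀ {n} → Interchangeable (sumFin {n})
sumFin-interchangeable {zero}  Σ-T f = sym (sum-0 Σ-T)
sumFin-interchangeable {suc n} {T = T} Σ-T f =
  trans (cong (T (f zero) +_) (sumFin-interchangeable Σ-T (f ∘ suc)))
        (sym (sum-+ Σ-T (f zero) (λ b → sumFin λ i → f (suc i) b)))

sumIf-summation : ∀ {P : Set} (d : Dec P) → (∀ (p q : P) → p ≡ q) → Summation (sumIf d)
sumIf-summation (yes p) irrelevant = record
  { sum-cong = λ f≡g → f≡g p ; sum-+ = λ _ _ → refl ; sum-* = λ _ _ → refl
  ; sum-nonneg = λ f 0≤f → 0≤f p ; sum-nonneg-≡0 = λ f _ fp≡0 q → trans (cong f (irrelevant q p)) fp≡0 }
sumIf-summation (no ¬p) _ = record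
  { sum-cong = λ _ → refl ; sum-+ = λ _ _ → sym (+-identityʳ 0ℚ) ; sum-* = λ c _ → sym (*-zeroʳ c)
  ; sum-nonneg = λ _ _ → ≤-refl ; sum-nonneg-≡0 = λ _ _ _ p → contradiction p ¬p }

sumIf-interchangeable : ∀ {P : Set} (d : Dec P) → Interchangeable (sumIf d)
sumIf-interchangeable (yes p) Σ-T f = refl
sumIf-interchangeable (no ¬p) Σ-T f = sym (sum-0 Σ-T)

module _ {A C : Set} {B : A → Set} {S : (A → ℚ) → ℚ} {T : (a : A) → (B a → ℚ) → ℚ}
         (g : (a : A) → B a → C) where

  nested-summation : Summation S → (∀ a → Summation (T a)) → (∀ c → ∃₂ λ a b → g a b ≡ c) →
    Summation (λ f → S (λ a → T a (λ b → f (g a b))))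
  nested-summation Σ-S Σ-T onto = record
    { sum-cong = λ f≡g → sum-cong Σ-S (λ a → sum-cong (Σ-T a) (λ b → f≡g (g a b)))
    ; sum-+ = λ f f′ → trans (sum-cong Σ-S (λ a → sum-+ (Σ-T a) _ _)) (sum-+ Σ-S _ _)
    ; sum-* = λ c f → trans (sum-cong Σ-S (λ a → sum-* (Σ-T a) c _)) (sum-* Σ-S c _)
    ; sum-nonneg = λ f 0≤f → sum-nonneg Σ-S _ (λ a → sum-nonneg (Σ-T a) _ (λ b → 0≤f (g a b)))
    ; sum-nonneg-≡0 = nonneg-≡0 }
    where
    nonneg-≡0 : ∀ f → (∀ c → 0ℚ ≤ f c) → S (λ a → T a (λ b → f (g a b))) ≡ 0ℚ → ∀ c → f c ≡ 0ℚ
    nonneg-≡0 f 0≤f Σf≡0 c with onto c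
    ... | a , b , refl = sum-nonneg-≡0 (Σ-T a) _ (λ b → 0≤f (g a b))
            (sum-nonneg-≡0 Σ-S _ (λ a → sum-nonneg (Σ-T a) _ (λ b → 0≤f (g a b))) Σf≡0 a) b

  nested-interchangeable : Summation S → Interchangeable S → (∀ a → Interchangeable (T a)) →
    Interchangeable (λ f → S (λ a → T a (λ b → f (g a b))))
  nested-interchangeable Σ-S S-swap T-swap Σ-U f =
    trans (sum-cong Σ-S (λ a → T-swap a Σ-U (λ b → f (g a b)))) (S-swap Σ-U _)

sumFin-perturb : ∀ {n} (f g : Fin n → ℚ) (a : Fin n) (c : ℚ) →
  g a ≡ f a + c → (∀ i → i ≢ a → g i ≡ f i) → sumFin g ≡ sumFin f + c
sumFin-perturb {suc n} f g zero c ga≡fa+c g≡f =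
  trans (cong₂ _+_ ga≡fa+c (sum-cong sumFin-summation (λ i → g≡f (suc i) λ ())))
        (solve 3 (λ x y z → (x :+ z) :+ y := (x :+ y) :+ z) refl (f zero) (sumFin (f ∘ suc)) c)
sumFin-perturb {suc n} f g (suc a) c ga≡fa+c g≡f =
  trans (cong₂ _+_ (g≡f zero λ ())
                   (sumFin-perturb (f ∘ suc) (g ∘ suc) a c ga≡fa+c
                                   (λ i i≢a → g≡f (suc i) (i≢a ∘ FinP.suc-injective))))
        (sym (+-assoc (f zero) (sumFin (f ∘ suc)) c))

sumFin-delta : ∀ {n} (h : Fin n → ℚ) (a : Fin n) → (∀ i → i ≢ a → h i ≡ 0ℚ) → sumFin h ≡ h a
sumFin-delta {n} h a h≡0 =
  trans (sumFin-perturb (λ _ → 0ℚ) h a (h a) (sym (+-identityˡ (h a))) h≡0)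
        (trans (cong (_+ h a) (sum-0 (sumFin-summation {n}))) (+-identityˡ (h a)))

indicator : ∀ {P : Set} → Dec P → ℚ
indicator d = ite d 1ℚ 0ℚ

sumFin-select : ∀ {n} {P : Fin n → Set} (P? : ∀ i → Dec (P i)) (a : Fin n) →
  (∀ i → P i → i ≡ a) → P a → (h : Fin n → ℚ) → sumFin (λ i → indicator (P? i) * h i) ≡ h a
sumFin-select {P = P} P? a P⇒≡a Pa h = trans (sumFin-delta _ a off-a) (at-a (P? a))
  where
  off-a : ∀ i → i ≢ a → indicator (P? i) * h i ≡ 0ℚ
  off-a i i≢a with P? i
  ... | yes Pi = contradiction (P⇒≡a i Pi) i≢a
  ... | no _   = *-zeroˡ (h i)
  at-a : (d : Dec (P a)) → indicator d * h a ≡ h a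
  at-a (yes _) = *-identityˡ (h a)
  at-a (no ¬Pa) = contradiction Pa ¬Pa

sumFin-punchIn : ∀ {m} (v : Fin (suc m)) (f : Fin (suc m) → ℚ) →
  sumFin f ≡ f v + sumFin (f ∘ punchIn v)
sumFin-punchIn         zero    f = refl
sumFin-punchIn {suc m} (suc v) f =
  trans (cong (f zero +_) (sumFin-punchIn v (f ∘ suc)))
        (solve 3 (λ a b c → a :+ (b :+ c) := b :+ (a :+ c)) refl (f zero) (f (suc v)) _)

when : Bool → ℚ → ℚ
when true  q = q
when false _ = 0ℚ

when-0 : ∀ b → when b 0ℚ ≡ 0ℚ
when-0 true  = refl
when-0 false = refl

when-split : ∀ b q → q ≡ when b q + when (not b) q
when-split true  q = sym (+-identityʳ q)
when-split false q = sym (+-identityˡ q)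

when-+ : ∀ b p q → when b (p + q) ≡ when b p + when b q
when-+ true  p q = refl
when-+ false p q = sym (+-identityʳ 0ℚ)

when-sumFin : ∀ {k} b (f : Fin k → ℚ) → when b (sumFin f) ≡ sumFin (λ i → when b (f i))
when-sumFin true  f = refl
when-sumFin {k} false f = sym (sum-0 (sumFin-summation {k}))

when-≡ : ∀ b q → (b ≡ false → q ≡ 0ℚ) → when b q ≡ q
when-≡ true  q _    = refl
when-≡ false q q≡0 = sym (q≡0 refl)

when-either : ∀ b c q → ¬ (b ≡ true × c ≡ true) → (b ∨ c ≡ false → q ≡ 0ℚ) → when b q + when c q ≡ q
when-either true  true  q ¬both _   = contradiction (refl , refl) ¬both
when-either true  false q _     _   = +-identityʳ q
when-either false true  q _     _   = +-identityˡ q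
when-either false false q _     q≡0 = trans (+-identityˡ 0ℚ) (sym (q≡0 refl))

≡-neg⇒≡0 : ∀ q → q ≡ - q → q ≡ 0ℚ
≡-neg⇒≡0 q q≡-q = begin
  q              ≡⟨ solve 1 (λ q → q := con ½ :* (q :+ q)) refl q ⟩
  ½ * (q + q)    ≡⟨ cong (λ p → ½ * (q + p)) q≡-q ⟩
  ½ * (q + - q)  ≡⟨ solve 1 (λ q → con ½ :* (q :+ :- q) := con 0ℚ) refl q ⟩
  0ℚ             ∎
  where open ≡-Reasoning

LinearForm : {A : Set} → ((A → ℚ) → ℚ) → Set
LinearForm {A} F = ∀ {k} (c : Fin k → ℚ) (z : Fin k → A → ℚ) →
  sumFin (λ l → c l * F (z l)) ≡ F (λ a → sumFin (λ l → c l * z l a))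

module _ {A : Set} where

  evaluation-linear : ∀ a → LinearForm {A} (λ x → x a)
  evaluation-linear a c z = refl

  zero-linear : LinearForm {A} (λ _ → 0ℚ)
  zero-linear c z = sum-≡0 sumFin-summation (λ l → *-zeroʳ (c l))

  +-linear : ∀ {F F′} → LinearForm {A} F → LinearForm F′ → LinearForm (λ x → F x + F′ x)
  +-linear {F} {F′} F-lin F′-lin c z = begin
    sumFin (λ l → c l * (F (z l) + F′ (z l)))
      ≡⟨ sum-cong sumFin-summation (λ l → *-distribˡ-+ (c l) (F (z l)) (F′ (z l))) ⟩
    sumFin (λ l → c l * F (z l) + c l * F′ (z l))
      ≡⟨ sum-+ sumFin-summation (λ l → c l * F (z l)) (λ l → c l * F′ (z l)) ⟩
    sumFin (λ l → c l * F (z l)) + sumFin (λ l → c l * F′ (z l))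
      ≡⟨ cong₂ _+_ (F-lin c z) (F′-lin c z) ⟩
    F (λ a → sumFin (λ l → c l * z l a)) + F′ (λ a → sumFin (λ l → c l * z l a)) ∎
    where open ≡-Reasoning

  neg-linear : ∀ {F} → LinearForm {A} F → LinearForm (λ x → - F x)
  neg-linear {F} F-lin c z = begin
    sumFin (λ l → c l * - F (z l))   ≡⟨ sum-cong sumFin-summation (λ l → neg-distribʳ-* (c l) (F (z l))) ⟨
    sumFin (λ l → - (c l * F (z l))) ≡⟨ sum-neg sumFin-summation (λ l → c l * F (z l)) ⟩
    - sumFin (λ l → c l * F (z l))   ≡⟨ cong -_ (F-lin c z) ⟩
    - F (λ a → sumFin (λ l → c l * z l a)) ∎
    where open ≡-Reasoning

  when-linear : ∀ {F} b → LinearForm {A} F → LinearForm (λ x → when b (F x))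
  when-linear true  F-lin = F-lin
  when-linear false _     = zero-linear

  sumIf-linear : ∀ {P : Set} (d : Dec P) (g : P → A) → LinearForm (λ x → sumIf d (λ p → x (g p)))
  sumIf-linear (yes p) g = evaluation-linear (g p)
  sumIf-linear (no _)  g = zero-linear

record IsLinear {A B : Set} (T : (A → ℚ) → B → ℚ) : Set where
  field
    pointwise-cong : ∀ {x y} → (∀ a → x a ≡ y a) → ∀ b → T x b ≡ T y b
    pointwise-linear : ∀ b → LinearForm (λ x → T x b)

  maps-zero : ∀ {x} → (∀ a → x a ≡ 0ℚ) → ∀ b → T x b ≡ 0ℚ
  maps-zero x≡0 b = trans (pointwise-cong x≡0 b) (sym (pointwise-linear b {0} (λ ()) (λ ())))
open IsLinear public

∘-linear : ∀ {A B C : Set} {S : (B → ℚ) → C → ℚ} {T : (A → ℚ) → B → ℚ} →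
  IsLinear S → IsLinear T → IsLinear (λ x → S (T x))
∘-linear {T = T} S-lin T-lin = record
  { pointwise-cong = λ x≡y → pointwise-cong S-lin (pointwise-cong T-lin x≡y)
  ; pointwise-linear = λ p c z → trans (pointwise-linear S-lin p c (λ l → T (z l)))
                                      (pointwise-cong S-lin (λ b → pointwise-linear T-lin b c z) p) }

∨≡true : ∀ {a b} → a ∨ b ≡ true → a ≡ true ⊎ b ≡ true
∨≡true {true}  _ = inj₁ refl
∨≡true {false} b = inj₂ b

∨-introʳ : ∀ a {b} → b ≡ true → a ∨ b ≡ true
∨-introʳ a refl = Bool.∨-zeroʳ a

∧≡true : ∀ {a b} → a ∧ b ≡ true → a ≡ true × b ≡ true
∧≡true {a} {b} ab = Bool.∧-conicalˡ a b ab , Bool.∧-conicalʳ a b ab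

≡true-ext : ∀ {a b} → (a ≡ true → b ≡ true) → (b ≡ true → a ≡ true) → a ≡ b
≡true-ext {false} {false} _ _ = refl
≡true-ext {false} {true}  _ b⇒a = b⇒a refl
≡true-ext {true}  {false} a⇒b _ = sym (a⇒b refl)
≡true-ext {true}  {true}  _ _ = refl

≡false⇒≢true : ∀ {b} → b ≡ false → b ≢ true
≡false⇒≢true refl ()

isYes≡true : ∀ {P : Set} {d : Dec P} → isYes d ≡ true → P
isYes≡true {d = yes p} _ = p

anyFin≡true : ∀ {n} {f : Fin n → Bool} → anyFin f ≡ true → ∃ λ i → f i ≡ true
anyFin≡true {suc n} {f} any with ∨≡true {f zero} any
... | inj₁ f0 = zero , f0
... | inj₂ rest with anyFin≡true rest
... | i , fi = suc i , fi

anyFin-intro : ∀ {n} (f : Fin n → Bool) i → f i ≡ true → anyFin f ≡ true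
anyFin-intro f zero    fi = cong (_∨ anyFin (f ∘ suc)) fi
anyFin-intro f (suc i) fi = ∨-introʳ (f zero) (anyFin-intro (f ∘ suc) i fi)

allFin-cong : ∀ {n} {f g : Fin n → Bool} → (∀ i → f i ≡ g i) → allFin f ≡ allFin g
allFin-cong {zero}  f≡g = refl
allFin-cong {suc n} f≡g = cong₂ _∧_ (f≡g zero) (allFin-cong (f≡g ∘ suc))

countFin-cong : ∀ {n} {f g : Fin n → Bool} → (∀ i → f i ≡ g i) → countFin f ≡ countFin g
countFin-cong {zero}  f≡g = refl
countFin-cong {suc n} {f} f≡g rewrite f≡g zero = cong (_ ℕ.+_) (countFin-cong (f≡g ∘ suc))

_⊆ᵇ_ : ∀ {n} → (Fin n → Bool) → (Fin n → Bool) → Set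
f ⊆ᵇ g = ∀ i → f i ≡ true → g i ≡ true

⊆ᵇ? : ∀ {n} (f g : Fin n → Bool) → f ⊆ᵇ g ⊎ ∃ λ i → f i ≡ true × g i ≡ false
⊆ᵇ? {zero}  f g = inj₁ λ ()
⊆ᵇ? {suc n} f g with ⊆ᵇ? (f ∘ suc) (g ∘ suc) | f zero in f0 | g zero in g0
... | inj₂ (i , fi , gi) | _     | _     = inj₂ (suc i , fi , gi)
... | inj₁ f⊆g           | false | _     = inj₁ λ { zero f0′ → contradiction f0′ (≡false⇒≢true f0) ; (suc i) → f⊆g i }
... | inj₁ f⊆g           | true  | true  = inj₁ λ { zero _ → g0 ; (suc i) → f⊆g i }
... | inj₁ f⊆g           | true  | false = inj₂ (zero , f0 , g0)

countFin-≤ : ∀ {n} (f : Fin n → Bool) → countFin f ℕ.≤ n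
countFin-≤ {zero}  f = ℕ.z≤n
countFin-≤ {suc n} f with f zero
... | true  = ℕ.s≤s (countFin-≤ (f ∘ suc))
... | false = ℕP.m≤n⇒m≤1+n (countFin-≤ (f ∘ suc))

countFin-mono : ∀ {n} (f g : Fin n → Bool) → f ⊆ᵇ g → countFin f ℕ.≤ countFin g
countFin-mono {zero}  f g f⊆g = ℕ.z≤n
countFin-mono {suc n} f g f⊆g with f zero in f0 | g zero in g0
... | false | false = countFin-mono (f ∘ suc) (g ∘ suc) (f⊆g ∘ suc)
... | false | true  = ℕP.m≤n⇒m≤1+n (countFin-mono (f ∘ suc) (g ∘ suc) (f⊆g ∘ suc))
... | true  | true  = ℕ.s≤s (countFin-mono (f ∘ suc) (g ∘ suc) (f⊆g ∘ suc))
... | true  | false with () ← trans (sym (f⊆g zero f0)) g0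

countFin-strict : ∀ {n} (f g : Fin n → Bool) → f ⊆ᵇ g → ∀ i → g i ≡ true → f i ≡ false →
  countFin f ℕ.< countFin g
countFin-strict {suc n} f g f⊆g zero g0 f0 rewrite g0 | f0 =
  ℕ.s≤s (countFin-mono (f ∘ suc) (g ∘ suc) (f⊆g ∘ suc))
countFin-strict {suc n} f g f⊆g (suc i) gi fi with f zero in f0 | g zero in g0
... | false | false = countFin-strict (f ∘ suc) (g ∘ suc) (f⊆g ∘ suc) i gi fi
... | false | true  = ℕP.m≤n⇒m≤1+n (countFin-strict (f ∘ suc) (g ∘ suc) (f⊆g ∘ suc) i gi fi)
... | true  | true  = ℕ.s≤s (countFin-strict (f ∘ suc) (g ∘ suc) (f⊆g ∘ suc) i gi fi)
... | true  | false with () ← trans (sym (f⊆g zero f0)) g0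

countFin-pos : ∀ {n} (f : Fin n → Bool) i → f i ≡ true → 1 ℕ.≤ countFin f
countFin-pos f zero    fi rewrite fi = ℕ.s≤s ℕ.z≤n
countFin-pos f (suc i) fi with f zero
... | true  = ℕ.s≤s ℕ.z≤n
... | false = countFin-pos (f ∘ suc) i fi

module _ {n : ℕ} (G : Graph n) where

  adj-sym : ∀ i j → adj G i j ≡ adj G j i
  adj-sym i j with i ≟ j | j ≟ i
  ... | yes refl | yes _ = refl
  ... | yes i≡j  | no j≢i = contradiction (sym i≡j) j≢i
  ... | no i≢j   | yes j≡i = contradiction (sym j≡i) i≢j
  ... | no _     | no _ = Bool.∨-comm (G i j) (G j i)

  adj-irrefl : ∀ i → adj G i i ≡ false
  adj-irrefl i with i ≟ i
  ... | yes _  = refl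
  ... | no i≢i = contradiction refl i≢i

  flip-adj : ∀ {i j} → adj G i j ≡ true → adj G j i ≡ true
  flip-adj {i} {j} ij = trans (adj-sym j i) ij

  adj⇒≢ : ∀ {i j} → adj G i j ≡ true → i ≢ j
  adj⇒≢ {i} ij refl with () ← trans (sym (adj-irrefl i)) ij

  IsEdge-irrelevant : ∀ {i j} (p q : IsEdge G i j) → p ≡ q
  IsEdge-irrelevant (i<j , ij) (i<j′ , ij′) =
    cong₂ _,_ (FinP.<-irrelevant i<j i<j′) (Decidable⇒UIP.≡-irrelevant Bool._≟_ ij ij′)

  IsTri-irrelevant : ∀ {a b c} (p q : IsTri G a b c) → p ≡ q
  IsTri-irrelevant (ab , bc , ac) (ab′ , bc′ , ac′) =
    cong₂ _,_ (IsEdge-irrelevant ab ab′) (cong₂ _,_ (IsEdge-irrelevant bc bc′) (IsEdge-irrelevant ac ac′))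

  private
    edgesFrom : (i : Fin n) → (Σ (Fin n) (IsEdge G i) → ℚ) → ℚ
    edgesFrom i f = sumFin λ j → sumIf (isEdge? G i j) λ p → f (j , p)

    trianglesFrom : (a b : Fin n) → (Σ (Fin n) (IsTri G a b) → ℚ) → ℚ
    trianglesFrom a b f = sumFin λ c → sumIf (isTri? G a b c) λ p → f (c , p)

    trianglesFrom₁ : (a : Fin n) → (Σ (Fin n × Fin n) (λ (b , c) → IsTri G a b c) → ℚ) → ℚ
    trianglesFrom₁ a f = sumFin λ b → trianglesFrom a b λ (c , p) → f ((b , c) , p)

  sumE-summation : Summation (sumE G)
  sumE-summation = nested-summation (λ i (j , p) → (i , j) , p) sumFin-summation
    (λ i → nested-summation (λ j p → j , p) sumFin-summation
             (λ j → sumIf-summation (isEdge? G i j) IsEdge-irrelevant) (λ (j , p) → j , p , refl))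
    (λ ((i , j) , p) → i , (j , p) , refl)

  sumE-interchangeable : Interchangeable (sumE G)
  sumE-interchangeable = nested-interchangeable {T = edgesFrom} (λ i (j , p) → (i , j) , p)
    sumFin-summation sumFin-interchangeable
    (λ i → nested-interchangeable {T = λ j → sumIf (isEdge? G i j)} (λ j p → j , p)
             sumFin-summation sumFin-interchangeable
             (λ j → sumIf-interchangeable (isEdge? G i j)))

  sumT-summation : Summation (sumT G)
  sumT-summation = nested-summation (λ a ((b , c) , p) → (a , b , c) , p) sumFin-summation
    (λ a → nested-summation (λ b (c , p) → (b , c) , p) sumFin-summation
      (λ b → nested-summation (λ c p → c , p) sumFin-summation
        (λ c → sumIf-summation (isTri? G a b c) IsTri-irrelevant) (λ (c , p) → c , p , refl))
      (λ ((b , c) , p) → b , (c , p) , refl))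
    (λ ((a , b , c) , p) → a , ((b , c) , p) , refl)

  sumT-interchangeable : Interchangeable (sumT G)
  sumT-interchangeable = nested-interchangeable {T = trianglesFrom₁} (λ a ((b , c) , p) → (a , b , c) , p)
    sumFin-summation sumFin-interchangeable
    (λ a → nested-interchangeable {T = trianglesFrom a} (λ b (c , p) → (b , c) , p)
      sumFin-summation sumFin-interchangeable
      (λ b → nested-interchangeable {T = λ c → sumIf (isTri? G a b c)} (λ c p → c , p)
        sumFin-summation sumFin-interchangeable
        (λ c → sumIf-interchangeable (isTri? G a b c))))

module _ {n : ℕ} (K : Graph n) where

  reachK-refl : ∀ k i → reachK K k i i ≡ true
  reachK-refl zero    i with i ≟ i
  ... | yes _  = refl
  ... | no i≢i = contradiction refl i≢i
  reachK-refl (suc k) i = cong (_∨ anyFin (λ w → reachK K k i w ∧ adj K w i)) (reachK-refl k i)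

  reachK-suc : ∀ k i j → reachK K k i j ≡ true → reachK K (suc k) i j ≡ true
  reachK-suc k i j r = cong (_∨ anyFin (λ w → reachK K k i w ∧ adj K w j)) r

  reachK-step : ∀ k i a b → reachK K k i a ≡ true → adj K a b ≡ true → reachK K (suc k) i b ≡ true
  reachK-step k i a b ra ab =
    ∨-introʳ (reachK K k i b)
             (anyFin-intro (λ w → reachK K k i w ∧ adj K w b) a (trans (cong (_∧ adj K a b) ra) ab))

  data ReachKSuc (k : ℕ) (i b : Fin n) : Set where
    shorter  : reachK K k i b ≡ true → ReachKSuc k i b
    via      : ∀ a → reachK K k i a ≡ true → adj K a b ≡ true → ReachKSuc k i b

  reachK-suc-view : ∀ k i b → reachK K (suc k) i b ≡ true → ReachKSuc k i b
  reachK-suc-view k i b r with ∨≡true {reachK K k i b} r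
  ... | inj₁ rb = shorter rb
  ... | inj₂ any with anyFin≡true any
  ... | a , ra∧ab with ∧≡true {reachK K k i a} ra∧ab
  ... | ra , ab = via a ra ab

  private
    R : ℕ → Fin n → Fin n → Bool
    R = reachK K

    stable : ∀ i k → R (suc k) i ⊆ᵇ R k i → R (suc (suc k)) i ⊆ᵇ R (suc k) i
    stable i k R′⊆R b r with reachK-suc-view (suc k) i b r
    ... | shorter rb = rb
    ... | via a ra ab = reachK-step k i a b (R′⊆R a ra) ab

    stable-or-growing : ∀ i k → R (suc k) i ⊆ᵇ R k i ⊎ suc (suc k) ℕ.≤ countFin (R (suc k) i)
    stable-or-growing i zero with ⊆ᵇ? (R 1 i) (R 0 i)
    ... | inj₁ R1⊆R0 = inj₁ R1⊆R0
    ... | inj₂ (b , r1 , r0) = inj₂ (ℕP.≤-trans (ℕ.s≤s (countFin-pos _ i (reachK-refl 0 i)))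
                                                 (countFin-strict _ _ (reachK-suc 0 i) b r1 r0))
    stable-or-growing i (suc k) with stable-or-growing i k
    ... | inj₁ R′⊆R = inj₁ (stable i k R′⊆R)
    ... | inj₂ grows with ⊆ᵇ? (R (suc (suc k)) i) (R (suc k) i)
    ...   | inj₁ R″⊆R′ = inj₁ R″⊆R′
    ...   | inj₂ (b , r″ , r′) =
      inj₂ (ℕP.≤-trans (ℕ.s≤s grows) (countFin-strict _ _ (reachK-suc (suc k) i) b r″ r′))

  -- Until the sets of vertices reachable in k steps stabilise, their sizes grow strictly; they are
  -- bounded by n.
  reach-saturated : ∀ i → R (suc n) i ⊆ᵇ reach K i
  reach-saturated i with stable-or-growing i n
  ... | inj₁ saturated = saturated
  ... | inj₂ grows = contradiction (ℕP.≤-trans grows (ℕP.m≤n⇒m≤1+n (countFin-≤ _))) ℕP.1+n≰n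

  reach-refl : ∀ i → reach K i i ≡ true
  reach-refl = reachK-refl n

  reach-step : ∀ i a b → reach K i a ≡ true → adj K a b ≡ true → reach K i b ≡ true
  reach-step i a b ra ab = reach-saturated i b (reachK-step n i a b ra ab)

  reach-trans : ∀ k i a b → reach K i a ≡ true → reachK K k a b ≡ true → reach K i b ≡ true
  reach-trans zero i a b ra r with isYes≡true {d = a ≟ b} r
  ... | refl = ra
  reach-trans (suc k) i a b ra r with reachK-suc-view k a b r
  ... | shorter r′ = reach-trans k i a b ra r′
  ... | via w rw wb = reach-step i w b (reach-trans k i a w ra rw) wb

  reach-sym : ∀ k i j → reachK K k i j ≡ true → reach K j i ≡ true
  reach-sym zero i j r with isYes≡true {d = i ≟ j} r
  ... | refl = reach-refl i
  reach-sym (suc k) i j r with reachK-suc-view k i j r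
  ... | shorter r′ = reach-sym k i j r′
  ... | via w rw wj = reach-trans n j w i (reach-step j j w (reach-refl j) (flip-adj K wj)) (reach-sym k i w rw)

reachK-⊆ : ∀ {n} (K K′ : Graph n) → (∀ a b → adj K a b ≡ true → adj K′ a b ≡ true) →
  ∀ k i j → reachK K k i j ≡ true → reachK K′ k i j ≡ true
reachK-⊆ K K′ K⊆K′ zero i j r = r
reachK-⊆ K K′ K⊆K′ (suc k) i j r with reachK-suc-view K k i j r
... | shorter r′ = reachK-suc K′ k i j (reachK-⊆ K K′ K⊆K′ k i j r′)
... | via a ra ab = reachK-step K′ k i a j (reachK-⊆ K K′ K⊆K′ k i a ra) (K⊆K′ a j ab)

-- The kernel of the Helmholtzian

module _ {n : ℕ} (G : Graph n) where

  divergence : (Edge G → ℚ) → Fin n → ℚ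
  divergence x w = sumE G (λ f → B G f w * x f)

  curl : (Edge G → ℚ) → Tri G → ℚ
  curl x t = sumE G (λ f → C G t f * x f)

  private
    sumE-swap-into : ∀ {W : Set} {S : (W → ℚ) → ℚ} → Summation S →
      (a : W → ℚ) (b : W → Edge G → ℚ) (x : Edge G → ℚ) →
      sumE G (λ f → S (λ w → a w * b w f) * x f) ≡ S (λ w → a w * sumE G (λ f → b w f * x f))
    sumE-swap-into Σ-S a b x =
      trans (sum-cong (sumE-summation G) (λ f → trans (sym (sum-*ʳ Σ-S (x f) _))
                                                      (sum-cong Σ-S (λ w → *-assoc (a w) (b w f) (x f)))))
      (trans (sumE-interchangeable G Σ-S (λ f w → a w * (b w f * x f)))
             (sum-cong Σ-S (λ w → sum-* (sumE-summation G) (a w) _)))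

    sumE-swap-out : ∀ {W : Set} {S : (W → ℚ) → ℚ} → Summation S → Interchangeable S →
      (a : Edge G → W → ℚ) (d : W → ℚ) (x : Edge G → ℚ) →
      sumE G (λ e → x e * S (λ w → a e w * d w)) ≡ S (λ w → sumE G (λ e → a e w * x e) * d w)
    sumE-swap-out Σ-S S-swap a d x =
      trans (sum-cong (sumE-summation G) (λ e → sym (sum-* Σ-S (x e) _)))
      (trans (sym (S-swap (sumE-summation G) (λ w e → x e * (a e w * d w))))
        (sum-cong Σ-S (λ w → trans (sum-cong (sumE-summation G) (λ e → rearrange (x e) (a e w) (d w)))
                                   (sum-*ʳ (sumE-summation G) (d w) (λ e → a e w * x e)))))
      where
      rearrange : ∀ p q r → p * (q * r) ≡ (q * p) * r
      rearrange = solve 3 (λ p q r → p :* (q :* r) := (q :* p) :* r) refl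

  applyH-split : ∀ x e → applyH G x e ≡
    sumFin (λ w → B G e w * divergence x w) + sumT G (λ t → C G t e * curl x t)
  applyH-split x e = begin
    sumE G (λ f → (BBᵀ f + CᵀC f) * x f)
      ≡⟨ sum-cong (sumE-summation G) (λ f → *-distribʳ-+ (x f) (BBᵀ f) (CᵀC f)) ⟩
    sumE G (λ f → BBᵀ f * x f + CᵀC f * x f)
      ≡⟨ sum-+ (sumE-summation G) _ _ ⟩
    sumE G (λ f → BBᵀ f * x f) + sumE G (λ f → CᵀC f * x f)
      ≡⟨ cong₂ _+_ (sumE-swap-into sumFin-summation (B G e) (λ w f → B G f w) x)
                   (sumE-swap-into (sumT-summation G) (λ t → C G t e) (C G) x) ⟩
    sumFin (λ w → B G e w * divergence x w) + sumT G (λ t → C G t e * curl x t) ∎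
    where
    open ≡-Reasoning
    BBᵀ CᵀC : Edge G → ℚ
    BBᵀ f = sumFin (λ w → B G e w * B G f w)
    CᵀC f = sumT G (λ t → C G t e * C G t f)

  energy : ∀ x → sumE G (λ e → x e * applyH G x e) ≡
    sumFin (λ w → divergence x w * divergence x w) + sumT G (λ t → curl x t * curl x t)
  energy x = begin
    sumE G (λ e → x e * applyH G x e)
      ≡⟨ sum-cong (sumE-summation G) (λ e → trans (cong (x e *_) (applyH-split x e))
                                                  (*-distribˡ-+ (x e) (Bdiv e) (Ccurl e))) ⟩
    sumE G (λ e → x e * Bdiv e + x e * Ccurl e)
      ≡⟨ sum-+ (sumE-summation G) _ _ ⟩
    sumE G (λ e → x e * Bdiv e) + sumE G (λ e → x e * Ccurl e)
      ≡⟨ cong₂ _+_ (sumE-swap-out sumFin-summation sumFin-interchangeable (B G) (divergence x) x)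
                   (sumE-swap-out (sumT-summation G) (sumT-interchangeable G) (λ e t → C G t e) (curl x) x) ⟩
    sumFin (λ w → divergence x w * divergence x w) + sumT G (λ t → curl x t * curl x t) ∎
    where
    open ≡-Reasoning
    Bdiv Ccurl : Edge G → ℚ
    Bdiv e = sumFin (λ w → B G e w * divergence x w)
    Ccurl e = sumT G (λ t → C G t e * curl x t)

  kernel⇒divergence-curl≡0 : ∀ x → InKernel G x → (∀ w → divergence x w ≡ 0ℚ) × (∀ t → curl x t ≡ 0ℚ)
  kernel⇒divergence-curl≡0 x Hx≡0 =
    (λ w → square≡0⇒≡0 _ (sum-nonneg-≡0 sumFin-summation _ (square-nonneg ∘ divergence x) div²≡0 w)) ,
    (λ t → square≡0⇒≡0 _ (sum-nonneg-≡0 (sumT-summation G) _ (square-nonneg ∘ curl x) curl²≡0 t))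
    where
    energy≡0 : sumE G (λ e → x e * applyH G x e) ≡ 0ℚ
    energy≡0 = sum-≡0 (sumE-summation G) (λ e → trans (cong (x e *_) (Hx≡0 e)) (*-zeroʳ (x e)))
    div²≡0,curl²≡0 = nonneg+nonneg≡0
      (sum-nonneg sumFin-summation _ (square-nonneg ∘ divergence x))
      (sum-nonneg (sumT-summation G) _ (square-nonneg ∘ curl x))
      (trans (sym (energy x)) energy≡0)
    div²≡0 = proj₁ div²≡0,curl²≡0
    curl²≡0 = proj₂ div²≡0,curl²≡0

  divergence-curl≡0⇒kernel : ∀ x → (∀ w → divergence x w ≡ 0ℚ) → (∀ t → curl x t ≡ 0ℚ) → InKernel G x
  divergence-curl≡0⇒kernel x div≡0 curl≡0 e = begin
    applyH G x e
      ≡⟨ applyH-split x e ⟩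
    sumFin (λ w → B G e w * divergence x w) + sumT G (λ t → C G t e * curl x t)
      ≡⟨ cong₂ _+_ (sum-≡0 sumFin-summation (λ w → trans (cong (B G e w *_) (div≡0 w)) (*-zeroʳ (B G e w))))
                   (sum-≡0 (sumT-summation G) (λ t → trans (cong (C G t e *_) (curl≡0 t)) (*-zeroʳ (C G t e)))) ⟩
    0ℚ + 0ℚ
      ≡⟨ +-identityʳ 0ℚ ⟩
    0ℚ ∎
    where open ≡-Reasoning

-- Flows

Flow : ℕ → Set
Flow n = Fin n → Fin n → ℚ

Skew : ∀ {n} → Flow n → Set
Skew W = ∀ i j → W i j ≡ - W j i

DivergenceFree : ∀ {n} → Flow n → Set
DivergenceFree W = ∀ w → sumFin (W w) ≡ 0ℚ

Cycle : ∀ {n} → Flow n → Fin n → Fin n → Fin n → Set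
Cycle W p q r = W p q + W q r + W r p ≡ 0ℚ

module _ {n : ℕ} (W : Flow n) where

  cycle-rotate : ∀ {p q r} → Cycle W p q r → Cycle W q r p
  cycle-rotate {p} {q} {r} = trans (solve 3 (λ x y z → y :+ z :+ x := x :+ y :+ z) refl (W p q) (W q r) (W r p))

  cycle-reverse : Skew W → ∀ {p q r} → Cycle W p q r → Cycle W q p r
  cycle-reverse skew {p} {q} {r} cyc = begin
    W q p + W p r + W r q       ≡⟨ cong₂ (λ s t → s + W p r + t) (skew q p) (skew r q) ⟩
    - W p q + W p r + - W q r   ≡⟨ cong (λ s → - W p q + s + - W q r) (skew p r) ⟩
    - W p q + - W r p + - W q r ≡⟨ solve 3 (λ x y z → :- x :+ :- z :+ :- y := :- (x :+ y :+ z)) refl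
                                           (W p q) (W q r) (W r p) ⟩
    - (W p q + W q r + W r p)   ≡⟨ cong -_ cyc ⟩
    - 0ℚ                        ≡⟨⟩
    0ℚ ∎
    where open ≡-Reasoning

skew-sum≡0 : ∀ {n} (A : Flow n) → Skew A → sumFin (λ i → sumFin (A i)) ≡ 0ℚ
skew-sum≡0 {n} A skew = ≡-neg⇒≡0 _ (begin
  sumFin (λ i → sumFin (A i))                  ≡⟨ sumFin-interchangeable sumFin-summation A ⟩
  sumFin (λ j → sumFin (λ i → A i j))          ≡⟨ sum-cong ΣFin (λ j → sum-cong ΣFin (λ i → skew i j)) ⟩
  sumFin (λ j → sumFin (λ i → - A j i))        ≡⟨ sum-cong ΣFin (λ j → sum-neg ΣFin (A j)) ⟩
  sumFin (λ j → - sumFin (A j))                ≡⟨ sum-neg ΣFin (λ j → sumFin (A j)) ⟩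
  - sumFin (λ j → sumFin (A j))                ∎)
  where
  open ≡-Reasoning
  ΣFin = sumFin-summation {n}

boundary-flow : ∀ {n} (T : Fin n → Bool) (X : Flow n) → Skew X →
  sumFin (λ w → when (T w) (sumFin (X w))) ≡ sumFin (λ w → sumFin (λ j → when (T w) (when (not (T j)) (X w j))))
boundary-flow {n} T X skew = begin
  sumFin (λ w → when (T w) (sumFin (X w)))
    ≡⟨ sum-cong ΣFin (λ w → trans (when-sumFin (T w) (X w)) (sum-cong ΣFin (λ j →
         trans (cong (when (T w)) (when-split (T j) (X w j))) (when-+ (T w) _ _)))) ⟩
  sumFin (λ w → sumFin (λ j → inner w j + across w j))
    ≡⟨ trans (sum-cong ΣFin (λ w → sum-+ ΣFin (inner w) (across w)))
             (sum-+ ΣFin (λ w → sumFin (inner w)) (λ w → sumFin (across w))) ⟩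
  sumFin (λ w → sumFin (inner w)) + sumFin (λ w → sumFin (across w))
    ≡⟨ cong (_+ sumFin (λ w → sumFin (across w))) (skew-sum≡0 inner inner-skew) ⟩
  0ℚ + sumFin (λ w → sumFin (across w))
    ≡⟨ +-identityˡ (sumFin (λ w → sumFin (across w))) ⟩
  sumFin (λ w → sumFin (across w)) ∎
  where
  open ≡-Reasoning
  ΣFin = sumFin-summation {n}
  inner across : Flow n
  inner w j = when (T w) (when (T j) (X w j))
  across w j = when (T w) (when (not (T j)) (X w j))
  inner-skew : Skew inner
  inner-skew w j with T w | T j
  ... | true  | true  = skew w j
  ... | true  | false = refl
  ... | false | true  = refl
  ... | false | false = refl

skew-swap : ∀ {n} {W W′ : Flow n} → Skew W → Skew W′ → ∀ {i j} → W j i ≡ W′ j i → W i j ≡ W′ i j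
skew-swap {W = W} {W′} skew skew′ {i} {j} eq = trans (skew i j) (trans (cong -_ eq) (sym (skew′ i j)))

module _ {n : ℕ} (G : Graph n) where

  IsFlow : Flow n → Set
  IsFlow W = Skew W × (∀ i j → adj G i j ≡ false → W i j ≡ 0ℚ)

  CurlFree : Flow n → Set
  CurlFree W = ∀ a b c → adj G a b ≡ true → adj G b c ≡ true → adj G a c ≡ true → Cycle W a b c

  IsHarmonic : Flow n → Set
  IsHarmonic W = DivergenceFree W × CurlFree W

  forward : (Edge G → ℚ) → Fin n → Fin n → ℚ
  forward x i j = sumIf (isEdge? G i j) (λ p → x ((i , j) , p))

  flowOf : (Edge G → ℚ) → Flow n
  flowOf x i j = forward x i j + - forward x j i

  restrict : Flow n → Edge G → ℚ
  restrict W ((i , j) , _) = W i j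

  forward-≮ : ∀ x i j → ¬ (i Fin.< j) → forward x i j ≡ 0ℚ
  forward-≮ x i j i≮j with isEdge? G i j
  ... | yes (i<j , _) = contradiction i<j i≮j
  ... | no _          = refl

  flowOf-skew : ∀ x → Skew (flowOf x)
  flowOf-skew x i j = solve 2 (λ a b → a :+ :- b := :- (b :+ :- a)) refl (forward x i j) (forward x j i)

  flowOf-isFlow : ∀ x → IsFlow (flowOf x)
  flowOf-isFlow x = flowOf-skew x , off-edges
    where
    forward-nonadj : ∀ i j → adj G i j ≡ false → forward x i j ≡ 0ℚ
    forward-nonadj i j ij with isEdge? G i j
    ... | yes (_ , ij′) with () ← trans (sym ij) ij′
    ... | no _ = refl
    off-edges : ∀ i j → adj G i j ≡ false → flowOf x i j ≡ 0ℚ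
    off-edges i j ij = cong₂ (λ p q → p + - q) (forward-nonadj i j ij)
                             (forward-nonadj j i (trans (adj-sym G j i) ij))

  restrict-flowOf : ∀ x e → restrict (flowOf x) e ≡ x e
  restrict-flowOf x ((i , j) , ij) with isEdge? G i j | isEdge? G j i
  ... | _       | yes ji  = contradiction (proj₁ ji) (FinP.<-asym (proj₁ ij))
  ... | no ¬ij  | no _    = contradiction ij ¬ij
  ... | yes ij′ | no _    = trans (+-identityʳ _) (cong (λ p → x ((i , j) , p)) (IsEdge-irrelevant G ij′ ij))

  flowOf-restrict : ∀ W → IsFlow W → ∀ i j → flowOf (restrict W) i j ≡ W i j
  flowOf-restrict W (skew , off-edges) i j with isEdge? G i j | isEdge? G j i
  ... | yes ij | yes ji = contradiction (proj₁ ji) (FinP.<-asym (proj₁ ij))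
  ... | yes _  | no _   = +-identityʳ _
  ... | no _   | yes _  = trans (+-identityˡ _) (sym (skew i j))
  ... | no ¬ij | no ¬ji = trans (+-identityʳ 0ℚ) (sym (off-edges i j nonadj))
    where
    nonadj : adj G i j ≡ false
    nonadj = Bool.¬-not λ ij → case FinP.<-cmp i j of λ where
      (tri< i<j _ _) → ¬ij (i<j , ij)
      (tri≈ _ i≡j _) → adj⇒≢ G ij i≡j
      (tri> _ _ j<i) → ¬ji (j<i , trans (adj-sym G j i) ij)

  private
    ΣFin : Summation (sumFin {n})
    ΣFin = sumFin-summation

    sumFin² : (Fin n → Fin n → ℚ) → ℚ
    sumFin² h = sumFin λ i → sumFin λ j → h i j

    sumFin²-cong : ∀ {h h′} → (∀ i j → h i j ≡ h′ i j) → sumFin² h ≡ sumFin² h′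
    sumFin²-cong h≡h′ = sum-cong ΣFin (λ i → sum-cong ΣFin (h≡h′ i))

    sumFin²-+ : ∀ h h′ → sumFin² (λ i j → h i j + h′ i j) ≡ sumFin² h + sumFin² h′
    sumFin²-+ h h′ = trans (sum-cong ΣFin (λ i → sum-+ ΣFin (h i) (h′ i)))
                           (sum-+ ΣFin (λ i → sumFin (h i)) (λ i → sumFin (h′ i)))

    sumFin²-neg : ∀ h → sumFin² (λ i j → - h i j) ≡ - sumFin² h
    sumFin²-neg h = trans (sum-cong ΣFin (λ i → sum-neg ΣFin (h i)))
                          (sum-neg ΣFin (λ i → sumFin (h i)))

    sumE-as-sumFin² : ∀ (k : Fin n → Fin n → ℚ) x →
      sumFin (λ i → sumFin (λ j → sumIf (isEdge? G i j) (λ p → k i j * x ((i , j) , p))))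
        ≡ sumFin² (λ i j → k i j * forward x i j)
    sumE-as-sumFin² k x =
      sumFin²-cong (λ i j → sum-* (sumIf-summation (isEdge? G i j) (IsEdge-irrelevant G)) (k i j) _)

    δ : Fin n → Fin n → ℚ
    δ p i = indicator (i ≟ p)

    sumFin²-δδ : ∀ (h : Fin n → Fin n → ℚ) p q → sumFin² (λ i j → (δ p i * δ q j) * h i j) ≡ h p q
    sumFin²-δδ h p q = begin
      sumFin² (λ i j → (δ p i * δ q j) * h i j)
        ≡⟨ sumFin²-cong (λ i j → *-assoc (δ p i) (δ q j) (h i j)) ⟩
      sumFin (λ i → sumFin (λ j → δ p i * (δ q j * h i j)))
        ≡⟨ sum-cong ΣFin (λ i → sum-* ΣFin (δ p i) (λ j → δ q j * h i j)) ⟩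
      sumFin (λ i → δ p i * sumFin (λ j → δ q j * h i j))
        ≡⟨ sumFin-select (_≟ p) p (λ _ → id) refl (λ i → sumFin (λ j → δ q j * h i j)) ⟩
      sumFin (λ j → δ q j * h p j)
        ≡⟨ sumFin-select (_≟ q) q (λ _ → id) refl (h p) ⟩
      h p q ∎
      where open ≡-Reasoning

  divergence-flowOf : ∀ x w → divergence G x w ≡ - sumFin (flowOf x w)
  divergence-flowOf x w = begin
    divergence G x w
      ≡⟨ sumE-as-sumFin² b x ⟩
    sumFin² (λ i j → b i j * f i j)
      ≡⟨ sumFin²-cong split ⟩
    sumFin² (λ i j → - (indicator (w ≟ i) * f i j) + indicator (w ≟ j) * f i j)
      ≡⟨ trans (sumFin²-+ (λ i j → - (indicator (w ≟ i) * f i j)) (λ i j → indicator (w ≟ j) * f i j))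
               (cong₂ _+_ (sumFin²-neg (λ i j → indicator (w ≟ i) * f i j))
                          (sum-cong ΣFin (λ i → at-w (f i)))) ⟩
    - sumFin² (λ i j → indicator (w ≟ i) * f i j) + sumFin (λ i → f i w)
      ≡⟨ cong (λ s → - s + sumFin (λ i → f i w))
              (trans (sum-cong ΣFin (λ i → sum-* ΣFin (indicator (w ≟ i)) (f i))) (at-w (sumFin ∘ f))) ⟩
    - sumFin (f w) + sumFin (λ i → f i w)
      ≡⟨ solve 2 (λ a b → :- a :+ b := :- (a :+ :- b)) refl (sumFin (f w)) (sumFin (λ i → f i w)) ⟩
    - (sumFin (f w) + - sumFin (λ i → f i w))
      ≡⟨ cong -_ (trans (sum-+ ΣFin (f w) (λ i → - f i w))
                        (cong (sumFin (f w) +_) (sum-neg ΣFin (λ i → f i w)))) ⟨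
    - sumFin (flowOf x w) ∎
    where
    open ≡-Reasoning
    f = forward x
    b : Fin n → Fin n → ℚ
    b i j = ite (w ≟ i) (- 1ℚ) (ite (w ≟ j) 1ℚ 0ℚ)
    at-w : ∀ h → sumFin (λ i → indicator (w ≟ i) * h i) ≡ h w
    at-w = sumFin-select (w ≟_) w (λ _ → sym) refl
    split : ∀ i j → b i j * f i j ≡ - (indicator (w ≟ i) * f i j) + indicator (w ≟ j) * f i j
    split i j with w ≟ i | w ≟ j
    ... | yes refl | yes refl rewrite forward-≮ x i i (FinP.<-irrefl refl) = refl
    ... | yes _ | no _ = solve 1 (λ s → (:- con 1ℚ) :* s := :- (con 1ℚ :* s) :+ con 0ℚ :* s) refl (f i j)
    ... | no _  | yes _ = solve 1 (λ s → con 1ℚ :* s := :- (con 0ℚ :* s) :+ con 1ℚ :* s) refl (f i j)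
    ... | no _  | no _ = solve 1 (λ s → con 0ℚ :* s := :- (con 0ℚ :* s) :+ con 0ℚ :* s) refl (f i j)

  curl-flowOf : ∀ x a b c (abc : IsTri G a b c) →
    curl G x ((a , b , c) , abc) ≡ flowOf x a b + flowOf x b c + flowOf x c a
  curl-flowOf x a b c abc@((a<b , _) , (b<c , _) , (a<c , _)) = begin
    curl G x ((a , b , c) , abc)
      ≡⟨ sumE-as-sumFin² k x ⟩
    sumFin² (λ i j → k i j * f i j)
      ≡⟨ sumFin²-cong (λ i j → trans (cong (_* f i j) (k-split i j))
           (solve 4 (λ A B C S → (A :+ B :+ :- C) :* S := A :* S :+ B :* S :+ :- (C :* S)) refl
                    (δ a i * δ b j) (δ b i * δ c j) (δ a i * δ c j) (f i j))) ⟩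
    sumFin² (λ i j → (δ a i * δ b j) * f i j + (δ b i * δ c j) * f i j + - ((δ a i * δ c j) * f i j))
      ≡⟨ trans (sumFin²-+ _ _) (cong₂ _+_ (sumFin²-+ _ _) (sumFin²-neg _)) ⟩
    sumFin² (λ i j → (δ a i * δ b j) * f i j) + sumFin² (λ i j → (δ b i * δ c j) * f i j)
      + - sumFin² (λ i j → (δ a i * δ c j) * f i j)
      ≡⟨ cong₂ _+_ (cong₂ _+_ (sumFin²-δδ f a b) (sumFin²-δδ f b c)) (cong -_ (sumFin²-δδ f a c)) ⟩
    f a b + f b c + - f a c
      ≡⟨ cong₂ _+_ (cong₂ _+_ (flowOf-< a<b) (flowOf-< b<c)) (flowOf-> a<c) ⟨
    flowOf x a b + flowOf x b c + flowOf x c a ∎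
    where
    open ≡-Reasoning
    f = forward x
    k : Fin n → Fin n → ℚ
    k i j = ite ((i ≟ a) ×-dec (j ≟ b)) 1ℚ
             (ite ((i ≟ b) ×-dec (j ≟ c)) 1ℚ
               (ite ((i ≟ a) ×-dec (j ≟ c)) (- 1ℚ) 0ℚ))
    k-split : ∀ i j → k i j ≡ δ a i * δ b j + δ b i * δ c j + - (δ a i * δ c j)
    k-split i j with i ≟ a | j ≟ b | i ≟ b | j ≟ c
    ... | yes refl | _ | yes a≡b | _ = contradiction a≡b (FinP.<⇒≢ a<b)
    ... | _ | yes refl | _ | yes b≡c = contradiction b≡c (FinP.<⇒≢ b<c)
    ... | yes _ | yes _ | no _  | no _  = refl
    ... | yes _ | no _  | no _  | yes _ = refl
    ... | yes _ | no _  | no _  | no _  = refl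
    ... | no _  | yes _ | yes _ | no _  = refl
    ... | no _  | yes _ | no _  | no _  = refl
    ... | no _  | no _  | yes _ | yes _ = refl
    ... | no _  | no _  | yes _ | no _  = refl
    ... | no _  | no _  | no _  | yes _ = refl
    ... | no _  | no _  | no _  | no _  = refl
    flowOf-< : ∀ {p q} → p Fin.< q → flowOf x p q ≡ f p q
    flowOf-< {p} {q} p<q = trans (cong (λ s → f p q + - s) (forward-≮ x q p (FinP.<-asym p<q)))
                                 (+-identityʳ (f p q))
    flowOf-> : ∀ {p q} → p Fin.< q → flowOf x q p ≡ - f p q
    flowOf-> {p} {q} p<q = trans (cong (_+ - f p q) (forward-≮ x q p (FinP.<-asym p<q)))
                                 (+-identityˡ (- f p q))

  curlFree-from-triangles : ∀ W → Skew W → (∀ a b c → IsTri G a b c → Cycle W a b c) → CurlFree W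
  curlFree-from-triangles W skew on-tri a b c ab bc ac
    with FinP.<-cmp a b | FinP.<-cmp b c | FinP.<-cmp a c
  ... | tri≈ _ a≡b _ | _ | _ = contradiction a≡b (adj⇒≢ G ab)
  ... | _ | tri≈ _ b≡c _ | _ = contradiction b≡c (adj⇒≢ G bc)
  ... | _ | _ | tri≈ _ a≡c _ = contradiction a≡c (adj⇒≢ G ac)
  ... | tri< a<b _ _ | tri< b<c _ _ | _ =
    on-tri a b c ((a<b , ab) , (b<c , bc) , (FinP.<-trans a<b b<c , ac))
  ... | tri< a<b _ _ | tri> _ _ c<b | tri< a<c _ _ =
    cycle-rotate W (cycle-reverse W skew (on-tri a c b ((a<c , ac) , (c<b , flip-adj G bc) , (a<b , ab))))
  ... | tri< a<b _ _ | tri> _ _ c<b | tri> _ _ c<a =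
    cycle-rotate W (on-tri c a b ((c<a , flip-adj G ac) , (a<b , ab) , (c<b , flip-adj G bc)))
  ... | tri> _ _ b<a | _ | tri< a<c _ _ =
    cycle-reverse W skew (on-tri b a c ((b<a , flip-adj G ab) , (a<c , ac) , (FinP.<-trans b<a a<c , bc)))
  ... | tri> _ _ b<a | tri< b<c _ _ | tri> _ _ c<a =
    cycle-rotate W (cycle-rotate W (on-tri b c a ((b<c , bc) , (c<a , flip-adj G ac) , (b<a , flip-adj G ab))))
  ... | tri> _ _ b<a | tri> _ _ c<b | tri> _ _ c<a =
    cycle-rotate W (cycle-rotate W (cycle-reverse W skew
      (on-tri c b a ((c<b , flip-adj G bc) , (b<a , flip-adj G ab) , (c<a , flip-adj G ac)))))

  kernel⇒harmonic : ∀ x → InKernel G x → IsHarmonic (flowOf x)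
  kernel⇒harmonic x Hx≡0 = div-free , curl-free
    where
    div≡0,curl≡0 = kernel⇒divergence-curl≡0 G x Hx≡0
    div-free : DivergenceFree (flowOf x)
    div-free w = neg-injective (trans (sym (divergence-flowOf x w)) (proj₁ div≡0,curl≡0 w))
    curl-free : CurlFree (flowOf x)
    curl-free = curlFree-from-triangles (flowOf x) (flowOf-skew x)
      (λ a b c abc → trans (sym (curl-flowOf x a b c abc)) (proj₂ div≡0,curl≡0 ((a , b , c) , abc)))

  harmonic⇒kernel : ∀ x → IsHarmonic (flowOf x) → InKernel G x
  harmonic⇒kernel x (div-free , curl-free) = divergence-curl≡0⇒kernel G x
    (λ w → trans (divergence-flowOf x w) (cong -_ (div-free w)))
    (λ ((a , b , c) , abc@((_ , ab) , (_ , bc) , (_ , ac))) →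
       trans (curl-flowOf x a b c abc) (curl-free a b c ab bc ac))

  IsHarmonic-cong : ∀ {W W′} → (∀ i j → W i j ≡ W′ i j) → IsHarmonic W → IsHarmonic W′
  IsHarmonic-cong W≡W′ (div-free , curl-free) =
    (λ w → trans (sum-cong sumFin-summation (λ j → sym (W≡W′ w j))) (div-free w)) ,
    (λ a b c ab bc ac → trans (sym (cong₂ _+_ (cong₂ _+_ (W≡W′ a b) (W≡W′ b c)) (W≡W′ c a)))
                             (curl-free a b c ab bc ac))


  flowOf-linear : IsLinear {B = Fin n × Fin n} (λ x (i , j) → flowOf x i j)
  flowOf-linear = record
    { pointwise-cong = λ x≡y (i , j) → cong₂ (λ p q → p + - q) (forward-cong x≡y i j) (forward-cong x≡y j i)
    ; pointwise-linear = λ (i , j) → +-linear {F = λ x → forward x i j} {F′ = λ x → - forward x j i}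
        (sumIf-linear (isEdge? G i j) (λ p → (i , j) , p))
        (neg-linear {F = λ x → forward x j i} (sumIf-linear (isEdge? G j i) (λ p → (j , i) , p))) }
    where
    forward-cong : ∀ {x y : Edge G → ℚ} → (∀ e → x e ≡ y e) → ∀ i j → forward x i j ≡ forward y i j
    forward-cong x≡y i j = sum-cong (sumIf-summation (isEdge? G i j) (IsEdge-irrelevant G)) (λ p → x≡y ((i , j) , p))

  restrict-linear : IsLinear {B = Edge G} (λ (W : Fin n × Fin n → ℚ) → restrict (curry W))
  restrict-linear = record
    { pointwise-cong = λ W≡W′ ((i , j) , _) → W≡W′ (i , j)
    ; pointwise-linear = λ ((i , j) , _) → evaluation-linear (i , j) }

-- Cut edges

record Separation {n : ℕ} (G : Graph n) (u v : Fin n) : Set where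
  field
    side    : Fin n → Bool
    side-u  : side u ≡ true
    side-v  : side v ≡ false
    leaving : ∀ a b → adj G a b ≡ true → side a ≡ true → side b ≡ false → a ≡ u × b ≡ v

module _ {n : ℕ} (G : Graph n) (u v : Fin n) (uv : IsEdge G u v) where

  private
    G∖uv : Graph n
    G∖uv = deleteEdge G ((u , v) , uv)

    adj-deleteEdge : ∀ a b → adj G a b ≡ true → ¬ (a ≡ u × b ≡ v) → ¬ (a ≡ v × b ≡ u) →
      adj G∖uv a b ≡ true
    adj-deleteEdge a b ab ¬uv ¬vu = trans (cong₂ (λ p q → not (isYes (a ≟ b)) ∧ (p ∨ q))
        (kept a b ¬uv ¬vu) (kept b a (¬vu ∘ swap) (¬uv ∘ swap))) ab
      where
      kept : ∀ a b → ¬ (a ≡ u × b ≡ v) → ¬ (a ≡ v × b ≡ u) → G∖uv a b ≡ G a b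
      kept a b ¬uv ¬vu with a ≟ u | b ≟ v | a ≟ v | b ≟ u
      ... | yes a≡u | yes b≡v | _ | _ = contradiction (a≡u , b≡v) ¬uv
      ... | _ | _ | yes a≡v | yes b≡u = contradiction (a≡v , b≡u) ¬vu
      ... | yes _ | no _  | yes _ | no _  = Bool.∧-identityʳ (G a b)
      ... | yes _ | no _  | no _  | _     = Bool.∧-identityʳ (G a b)
      ... | no _  | _     | yes _ | no _  = Bool.∧-identityʳ (G a b)
      ... | no _  | _     | no _  | _     = Bool.∧-identityʳ (G a b)

    adj-deleteEdge-⊆ : ∀ a b → adj G∖uv a b ≡ true → adj G a b ≡ true
    adj-deleteEdge-⊆ a b ab with ∧≡true {not (isYes (a ≟ b))} ab
    ... | a≢b , G∖uv-ab with ∨≡true {G∖uv a b} G∖uv-ab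
    ... | inj₁ Gab = cong₂ _∧_ a≢b (cong (_∨ G b a) (Bool.∧-conicalˡ _ _ Gab))
    ... | inj₂ Gba = cong₂ _∧_ a≢b (∨-introʳ (G a b) (Bool.∧-conicalˡ _ _ Gba))

    reach-bypass : reach G∖uv u v ≡ true → ∀ k a b → reachK G k a b ≡ true → reach G∖uv a b ≡ true
    reach-bypass u⇝v zero a b r with isYes≡true {d = a ≟ b} r
    ... | refl = reach-refl G∖uv a
    reach-bypass u⇝v (suc k) a b r with reachK-suc-view G k a b r
    ... | shorter r′ = reach-bypass u⇝v k a b r′
    ... | via w rw wb with reach-bypass u⇝v k a w rw | w ≟ u | b ≟ v | w ≟ v | b ≟ u
    ...   | a⇝w | yes refl | yes refl | _ | _ = reach-trans G∖uv n a u v a⇝w u⇝v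
    ...   | a⇝w | _ | _ | yes refl | yes refl = reach-trans G∖uv n a v u a⇝w (reach-sym G∖uv n u v u⇝v)
    ...   | a⇝w | no w≢u | _ | no w≢v | _ =
      reach-step G∖uv a w b a⇝w (adj-deleteEdge w b wb (w≢u ∘ proj₁) (w≢v ∘ proj₁))
    ...   | a⇝w | no w≢u | _ | yes _ | no b≢u =
      reach-step G∖uv a w b a⇝w (adj-deleteEdge w b wb (w≢u ∘ proj₁) (b≢u ∘ proj₂))
    ...   | a⇝w | yes _ | no b≢v | no w≢v | _ =
      reach-step G∖uv a w b a⇝w (adj-deleteEdge w b wb (b≢v ∘ proj₂) (w≢v ∘ proj₁))
    ...   | a⇝w | yes _ | no b≢v | yes _ | no b≢u =
      reach-step G∖uv a w b a⇝w (adj-deleteEdge w b wb (b≢v ∘ proj₂) (b≢u ∘ proj₂))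

    components-bypass : reach G∖uv u v ≡ true → components G ≡ components G∖uv
    components-bypass u⇝v = countFin-cong λ w → allFin-cong λ a →
      cong (λ r → not (isYes (a <? w)) ∨ not r) (≡true-ext (reach-bypass u⇝v n a w)
                                                           (reachK-⊆ G∖uv G adj-deleteEdge-⊆ n a w))

  cutEdge-separation : IsCutEdge G ((u , v) , uv) → Separation G u v
  cutEdge-separation cut = record
    { side = reach G∖uv u ; side-u = reach-refl G∖uv u ; side-v = u↛v ; leaving = leaving }
    where
    u↛v : reach G∖uv u v ≡ false
    u↛v = Bool.¬-not λ u⇝v → ℕP.<-irrefl (components-bypass u⇝v) cut
    leaving : ∀ a b → adj G a b ≡ true → reach G∖uv u a ≡ true → reach G∖uv u b ≡ false → a ≡ u × b ≡ v
    leaving a b ab u⇝a u↛b with (a ≟ u) ×-dec (b ≟ v)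
    ... | yes a≡u×b≡v = a≡u×b≡v
    ... | no ¬uv =
      contradiction (reach-step G∖uv u a b u⇝a (adj-deleteEdge a b ab ¬uv ¬vu)) (≡false⇒≢true u↛b)
      where
      ¬vu : ¬ (a ≡ v × b ≡ u)
      ¬vu (refl , _) = ≡false⇒≢true u↛v u⇝a

module _ {n : ℕ} {G : Graph n} {u v : Fin n} (sep : Separation G u v) where

  open Separation sep

  side-closed : ∀ a b → adj G a b ≡ true → a ≢ u → side a ≡ true → side b ≡ true
  side-closed a b ab a≢u sa with side b in sb
  ... | true  = refl
  ... | false = contradiction (proj₁ (leaving a b ab sa sb)) a≢u

  u-neighbour-side : ∀ y → adj G u y ≡ true → y ≢ v → side y ≡ true
  u-neighbour-side y uy y≢v with side y in sy
  ... | true  = refl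
  ... | false = contradiction (proj₂ (leaving u y uy side-u sy)) y≢v

  v-neighbour-side : ∀ y → adj G v y ≡ true → y ≢ u → side y ≡ false
  v-neighbour-side y vy y≢u with side y in sy
  ... | false = refl
  ... | true  = contradiction (proj₁ (leaving y v (flip-adj G vy) sy side-v)) y≢u

  no-common-neighbour : ∀ y → adj G u y ≡ true → adj G v y ≡ true → ⊥
  no-common-neighbour y uy vy =
    ≡false⇒≢true (v-neighbour-side y vy (adj⇒≢ G uy ∘ sym)) (u-neighbour-side y uy (adj⇒≢ G vy ∘ sym))

  nonadj-v : ∀ {y} → adj G u y ≡ true → adj G v y ≡ false
  nonadj-v {y} uy = Bool.¬-not (no-common-neighbour y uy)

  nonadj-u : ∀ {y} → adj G v y ≡ true → adj G u y ≡ false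
  nonadj-u {y} vy = Bool.¬-not λ uy → no-common-neighbour y uy vy

  uv-row-sum : ∀ X → IsFlow G X → ∀ {w j} → w ≡ u ⊎ w ≡ v → adj G w j ≡ true → X u j + X v j ≡ X w j
  uv-row-sum X (_ , off-edges) {j = j} (inj₁ refl) uj =
    trans (cong (X u j +_) (off-edges v j (nonadj-v uj))) (+-identityʳ _)
  uv-row-sum X (_ , off-edges) {j = j} (inj₂ refl) vj =
    trans (cong (_+ X v j) (off-edges u j (nonadj-u vj))) (+-identityˡ _)

  uv-column-sum : ∀ X → IsFlow G X → ∀ {w j} → w ≡ u ⊎ w ≡ v → adj G w j ≡ true → X j u + X j v ≡ X j w
  uv-column-sum X (_ , off-edges) {j = j} (inj₁ refl) uj =
    trans (cong (X j u +_) (off-edges j v (trans (adj-sym G j v) (nonadj-v uj)))) (+-identityʳ _)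
  uv-column-sum X (_ , off-edges) {j = j} (inj₂ refl) vj =
    trans (cong (_+ X j v) (off-edges j u (trans (adj-sym G j u) (nonadj-u vj)))) (+-identityˡ _)

  uv-neighbour : ∀ {j} → adj G u j ∨ adj G v j ≡ true → ∃ λ w → (w ≡ u ⊎ w ≡ v) × adj G w j ≡ true
  uv-neighbour {j} uj∨vj with ∨≡true {adj G u j} uj∨vj
  ... | inj₁ uj = u , inj₁ refl , uj
  ... | inj₂ vj = v , inj₂ refl , vj

  same-uv-neighbour : ∀ {w j k} → w ≡ u ⊎ w ≡ v → j ≢ u → j ≢ v → k ≢ u → k ≢ v →
    adj G w j ≡ true → adj G j k ≡ true → adj G u k ∨ adj G v k ≡ true → adj G w k ≡ true
  same-uv-neighbour {j = j} {k} (inj₁ refl) j≢u j≢v k≢u k≢v uj jk uk∨vk with ∨≡true {adj G u k} uk∨vk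
  ... | inj₁ uk = uk
  ... | inj₂ vk = contradiction (side-closed j k jk j≢u (u-neighbour-side j uj j≢v))
                                (≡false⇒≢true (v-neighbour-side k vk k≢u))
  same-uv-neighbour {j = j} {k} (inj₂ refl) j≢u j≢v k≢u k≢v vj jk uk∨vk with ∨≡true {adj G u k} uk∨vk
  ... | inj₂ vk = vk
  ... | inj₁ uk = contradiction (side-closed k j (flip-adj G jk) k≢u (u-neighbour-side k uk k≢v))
                                (≡false⇒≢true (v-neighbour-side j vj j≢u))

  -- The total divergence over the side of u is the net flow leaving it, which is the flow on uv.
  separating-edge-flow≡0 : ∀ X → IsFlow G X → DivergenceFree X → X u v ≡ 0ℚ
  separating-edge-flow≡0 X (skew , off-edges) div-free = begin
    X u v
      ≡⟨ cong₂ (λ s t → when s (when (not t) (X u v))) side-u side-v ⟨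
    across u v
      ≡⟨ sumFin-delta (across u) v (λ j j≢v → across-only-uv u j (j≢v ∘ proj₂)) ⟨
    sumFin (across u)
      ≡⟨ sumFin-delta (sumFin ∘ across) u
                      (λ w w≢u → sum-≡0 ΣFin (λ j → across-only-uv w j (w≢u ∘ proj₁))) ⟨
    sumFin (λ w → sumFin (across w))
      ≡⟨ boundary-flow side X skew ⟨
    sumFin (λ w → when (side w) (sumFin (X w)))
      ≡⟨ sum-≡0 ΣFin (λ w → trans (cong (when (side w)) (div-free w)) (when-0 (side w))) ⟩
    0ℚ ∎
    where
    open ≡-Reasoning
    ΣFin = sumFin-summation {n}
    across : Flow n
    across w j = when (side w) (when (not (side j)) (X w j))
    across-only-uv : ∀ w j → ¬ (w ≡ u × j ≡ v) → across w j ≡ 0ℚ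
    across-only-uv w j ¬uv with side w in sw | side j in sj
    ... | false | _    = refl
    ... | true  | true = refl
    ... | true  | false with adj G w j in wj
    ...   | false = off-edges w j wj
    ...   | true  = contradiction (leaving w j wj sw sj) ¬uv

-- Contraction of an edge

module Contraction {m : ℕ} (G : Graph (suc m)) (u v : Fin (suc m)) (uv : IsEdge G u v) where

  G/uv : Graph m
  G/uv = contract G ((u , v) , uv)

  u≢v : u ≢ v
  u≢v = adj⇒≢ G (proj₂ uv)

  embed : Fin m → Fin (suc m)
  embed = punchIn v

  merged : Fin m
  merged = punchOut (u≢v ∘ sym)

  collapse : Fin (suc m) → Fin m
  collapse j with v ≟ j
  ... | yes _  = merged
  ... | no v≢j = punchOut v≢j

  embed-merged : embed merged ≡ u
  embed-merged = FinP.punchIn-punchOut _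

  embed≢v : ∀ a → embed a ≢ v
  embed≢v = FinP.punchInᵢ≢i v

  embed-injective : ∀ {a b} → embed a ≡ embed b → a ≡ b
  embed-injective = FinP.punchIn-injective v _ _

  embed≡u : ∀ {a} → embed a ≡ u → a ≡ merged
  embed≡u eq = embed-injective (trans eq (sym embed-merged))

  embed-collapse : ∀ j → j ≢ v → embed (collapse j) ≡ j
  embed-collapse j j≢v with v ≟ j
  ... | yes v≡j = contradiction (sym v≡j) j≢v
  ... | no v≢j  = FinP.punchIn-punchOut v≢j

  collapse-v : collapse v ≡ merged
  collapse-v with v ≟ v
  ... | yes _  = refl
  ... | no v≢v = contradiction refl v≢v

  collapse-embed : ∀ a → collapse (embed a) ≡ a
  collapse-embed a = embed-injective (embed-collapse (embed a) (embed≢v a))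

  collapse-u : collapse u ≡ merged
  collapse-u = trans (cong collapse (sym embed-merged)) (collapse-embed merged)

  embed-collapse-v : embed (collapse v) ≡ u
  embed-collapse-v = trans (cong embed collapse-v) embed-merged

  embed-collapse-u : embed (collapse u) ≡ u
  embed-collapse-u = trans (cong embed collapse-u) embed-merged

  embed-collapse-endpoint : ∀ {w} → w ≡ u ⊎ w ≡ v → embed (collapse w) ≡ u
  embed-collapse-endpoint (inj₁ refl) = embed-collapse-u
  embed-collapse-endpoint (inj₂ refl) = embed-collapse-v

  data Endpoint (i : Fin (suc m)) : Set where
    is-u  : i ≡ u → Endpoint i
    is-v  : i ≡ v → Endpoint i
    other : i ≢ u → i ≢ v → Endpoint i

  endpoint : ∀ i → Endpoint i
  endpoint i with i ≟ u | i ≟ v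
  ... | yes i≡u | _       = is-u i≡u
  ... | no _    | yes i≡v = is-v i≡v
  ... | no i≢u  | no i≢v  = other i≢u i≢v

  -- G/uv has the vertices of G other than v (via embed), u standing for the merged vertex;
  -- merge adds up the rows and the columns of u and v.
  merge : {A : Set} → (A → A → A) → A → (Fin (suc m) → Fin (suc m) → A) → Fin (suc m) → Fin (suc m) → A
  merge _∙_ ε W i j with i ≟ u | j ≟ u
  ... | yes _ | yes _ = ε
  ... | yes _ | no _  = W u j ∙ W v j
  ... | no _  | yes _ = W i u ∙ W i v
  ... | no _  | no _  = W i j

  module _ {A : Set} (_∙_ : A → A → A) (ε : A) (W : Fin (suc m) → Fin (suc m) → A) where

    merge-uu : ∀ {i j} → i ≡ u → j ≡ u → merge _∙_ ε W i j ≡ ε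
    merge-uu {i} {j} i≡u j≡u with i ≟ u | j ≟ u
    ... | yes _ | yes _    = refl
    ... | no i≢u | _       = contradiction i≡u i≢u
    ... | yes _ | no j≢u   = contradiction j≡u j≢u

    merge-u• : ∀ {i j} → i ≡ u → j ≢ u → merge _∙_ ε W i j ≡ W u j ∙ W v j
    merge-u• {i} {j} i≡u j≢u with i ≟ u | j ≟ u
    ... | yes _ | no _     = refl
    ... | no i≢u | _       = contradiction i≡u i≢u
    ... | yes _ | yes j≡u  = contradiction j≡u j≢u

    merge-•u : ∀ {i j} → i ≢ u → j ≡ u → merge _∙_ ε W i j ≡ W i u ∙ W i v
    merge-•u {i} {j} i≢u j≡u with i ≟ u | j ≟ u
    ... | no _ | yes _     = refl
    ... | yes i≡u | _      = contradiction i≡u i≢u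
    ... | no _ | no j≢u    = contradiction j≡u j≢u

    merge-•• : ∀ {i j} → i ≢ u → j ≢ u → merge _∙_ ε W i j ≡ W i j
    merge-•• {i} {j} i≢u j≢u with i ≟ u | j ≟ u
    ... | no _ | no _      = refl
    ... | yes i≡u | _      = contradiction i≡u i≢u
    ... | no _ | yes j≡u   = contradiction j≡u j≢u

  private
    ∨-self-sym : ∀ {x y x′ y′} → x′ ≡ x → y′ ≡ y → (x ∨ y) ∨ (x′ ∨ y′) ≡ x ∨ y
    ∨-self-sym {x} {y} refl refl = Bool.∨-idem (x ∨ y)

  adj-contract : ∀ a b → adj G/uv a b ≡ merge _∨_ false (adj G) (embed a) (embed b)
  adj-contract a b with embed a ≟ u | embed b ≟ u | a ≟ b
  ... | yes au | yes bu | yes _   = refl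
  ... | yes au | yes bu | no a≢b  = contradiction (embed-injective (trans au (sym bu))) a≢b
  ... | yes au | no b≢u | yes refl = contradiction au b≢u
  ... | yes au | no b≢u | no _    = ∨-self-sym (adj-sym G (embed b) u) (adj-sym G (embed b) v)
  ... | no a≢u | yes bu | yes refl = contradiction bu a≢u
  ... | no a≢u | yes bu | no _    = ∨-self-sym (adj-sym G u (embed a)) (adj-sym G v (embed a))
  ... | no a≢u | no b≢u | yes refl = sym (adj-irrefl G (embed a))
  ... | no a≢u | no b≢u | no _    = trans (cong (adj G (embed a) (embed b) ∨_) (adj-sym G (embed b) (embed a)))
                                           (Bool.∨-idem _)

  adj-contract-•• : ∀ {a b} → embed a ≢ u → embed b ≢ u → adj G/uv a b ≡ adj G (embed a) (embed b)
  adj-contract-•• {a} {b} a≢u b≢u = trans (adj-contract a b) (merge-•• _∨_ false (adj G) a≢u b≢u)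

  adj-contract-u• : ∀ {a b} → embed a ≡ u → embed b ≢ u →
    adj G/uv a b ≡ adj G u (embed b) ∨ adj G v (embed b)
  adj-contract-u• {a} {b} au b≢u = trans (adj-contract a b) (merge-u• _∨_ false (adj G) au b≢u)

  adj-contract-•u : ∀ {a b} → embed a ≢ u → embed b ≡ u →
    adj G/uv a b ≡ adj G (embed a) u ∨ adj G (embed a) v
  adj-contract-•u {a} {b} a≢u bu = trans (adj-contract a b) (merge-•u _∨_ false (adj G) a≢u bu)

  pushFlow : Flow (suc m) → Flow m
  pushFlow X a b = merge _+_ 0ℚ X (embed a) (embed b)

  pullFlow : Flow m → Flow (suc m)
  pullFlow Y i j = when (adj G i j) (Y (collapse i) (collapse j))

  merge-skew : ∀ X → Skew X → Skew (merge _+_ 0ℚ X)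
  merge-skew X skew i j with i ≟ u | j ≟ u
  ... | yes _ | yes _ = refl
  ... | yes _ | no _  = trans (cong₂ _+_ (skew u j) (skew v j)) (sym (neg-distrib-+ (X j u) (X j v)))
  ... | no _  | yes _ = trans (cong₂ _+_ (skew i u) (skew i v)) (sym (neg-distrib-+ (X u i) (X v i)))
  ... | no _  | no _  = skew i j

  merge-support : ∀ X → IsFlow G X → ∀ i j →
    merge _∨_ false (adj G) i j ≡ false → merge _+_ 0ℚ X i j ≡ 0ℚ
  merge-support X (_ , off-edges) i j merged-nonadj with i ≟ u | j ≟ u
  ... | yes _ | yes _ = refl
  ... | yes _ | no _  = cong₂ _+_ (off-edges u j (Bool.∨-conicalˡ _ _ merged-nonadj))
                                  (off-edges v j (Bool.∨-conicalʳ _ _ merged-nonadj))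
  ... | no _  | yes _ = cong₂ _+_ (off-edges i u (Bool.∨-conicalˡ _ _ merged-nonadj))
                                  (off-edges i v (Bool.∨-conicalʳ _ _ merged-nonadj))
  ... | no _  | no _  = off-edges i j merged-nonadj

  pushFlow-isFlow : ∀ X → IsFlow G X → IsFlow G/uv (pushFlow X)
  pushFlow-isFlow X flow@(skew , _) =
    (λ a b → merge-skew X skew (embed a) (embed b)) ,
    (λ a b ab → merge-support X flow (embed a) (embed b) (trans (sym (adj-contract a b)) ab))

  pullFlow-isFlow : ∀ Y → IsFlow G/uv Y → IsFlow G (pullFlow Y)
  pullFlow-isFlow Y (skew , _) = pull-skew , λ i j ij → cong (λ b → when b (Y (collapse i) (collapse j))) ij
    where
    pull-skew : Skew (pullFlow Y)
    pull-skew i j rewrite adj-sym G i j with adj G j i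
    ... | true  = skew (collapse i) (collapse j)
    ... | false = refl

  adj-collapse : ∀ i j → adj G i j ≡ true → ¬ (i ≡ u × j ≡ v) → ¬ (i ≡ v × j ≡ u) →
    adj G/uv (collapse i) (collapse j) ≡ true
  adj-collapse i j ij ¬uv ¬vu = trans (adj-contract (collapse i) (collapse j)) (by-cases (i ≟ v) (j ≟ v))
    where
    M = merge _∨_ false (adj G)
    by-cases : Dec (i ≡ v) → Dec (j ≡ v) → M (embed (collapse i)) (embed (collapse j)) ≡ true
    by-cases (yes refl) (yes refl) = contradiction refl (adj⇒≢ G ij)
    by-cases (yes refl) (no j≢v)   = begin
      M (embed (collapse v)) (embed (collapse j))  ≡⟨ cong₂ M embed-collapse-v (embed-collapse j j≢v) ⟩
      M u j                                        ≡⟨ merge-u• _∨_ false (adj G) refl (λ j≡u → ¬vu (refl , j≡u)) ⟩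
      adj G u j ∨ adj G v j                        ≡⟨ ∨-introʳ (adj G u j) ij ⟩
      true ∎
      where open ≡-Reasoning
    by-cases (no i≢v) (yes refl)   = begin
      M (embed (collapse i)) (embed (collapse v))  ≡⟨ cong₂ M (embed-collapse i i≢v) embed-collapse-v ⟩
      M i u                                        ≡⟨ merge-•u _∨_ false (adj G) (λ i≡u → ¬uv (i≡u , refl)) refl ⟩
      adj G i u ∨ adj G i v                        ≡⟨ ∨-introʳ (adj G i u) ij ⟩
      true ∎
      where open ≡-Reasoning
    by-cases (no i≢v) (no j≢v) =
      trans (cong₂ M (embed-collapse i i≢v) (embed-collapse j j≢v)) (unmerged (i ≟ u) (j ≟ u))
      where
      unmerged : Dec (i ≡ u) → Dec (j ≡ u) → M i j ≡ true
      unmerged (yes refl) (yes refl) = contradiction refl (adj⇒≢ G ij)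
      unmerged (yes refl) (no j≢u)   = trans (merge-u• _∨_ false (adj G) refl j≢u) (cong (_∨ _) ij)
      unmerged (no i≢u)   (yes refl) = trans (merge-•u _∨_ false (adj G) i≢u refl) (cong (_∨ _) ij)
      unmerged (no i≢u)   (no j≢u)   = trans (merge-•• _∨_ false (adj G) i≢u j≢u) ij

  pushFlow-linear : IsLinear {A = Fin (suc m) × Fin (suc m)} {B = Fin m × Fin m} (λ X (a , b) → pushFlow (curry X) a b)
  pushFlow-linear = record
    { pointwise-cong = λ X≡X′ (a , b) → merge-cong X≡X′ (embed a) (embed b)
    ; pointwise-linear = λ (a , b) → merge-linear (embed a) (embed b) }
    where
    merge-cong : ∀ {X X′ : Fin (suc m) × Fin (suc m) → ℚ} → (∀ p → X p ≡ X′ p) →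
      ∀ i j → merge _+_ 0ℚ (curry X) i j ≡ merge _+_ 0ℚ (curry X′) i j
    merge-cong X≡X′ i j with i ≟ u | j ≟ u
    ... | yes _ | yes _ = refl
    ... | yes _ | no _  = cong₂ _+_ (X≡X′ (u , j)) (X≡X′ (v , j))
    ... | no _  | yes _ = cong₂ _+_ (X≡X′ (i , u)) (X≡X′ (i , v))
    ... | no _  | no _  = X≡X′ (i , j)
    merge-linear : ∀ i j → LinearForm (λ X → merge _+_ 0ℚ (curry X) i j)
    merge-linear i j with i ≟ u | j ≟ u
    ... | yes _ | yes _ = zero-linear
    ... | yes _ | no _  = +-linear {F = λ X → X (u , j)} {F′ = λ X → X (v , j)}
                                   (evaluation-linear (u , j)) (evaluation-linear (v , j))
    ... | no _  | yes _ = +-linear {F = λ X → X (i , u)} {F′ = λ X → X (i , v)}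
                                   (evaluation-linear (i , u)) (evaluation-linear (i , v))
    ... | no _  | no _  = evaluation-linear (i , j)

  pullFlow-linear : IsLinear {A = Fin m × Fin m} {B = Fin (suc m) × Fin (suc m)} (λ Y (i , j) → pullFlow (curry Y) i j)
  pullFlow-linear = record
    { pointwise-cong = λ Y≡Y′ (i , j) → cong (when (adj G i j)) (Y≡Y′ (collapse i , collapse j))
    ; pointwise-linear = λ (i , j) → when-linear {F = λ Y → Y (collapse i , collapse j)} (adj G i j)
                                       (evaluation-linear (collapse i , collapse j)) }

module SeparatedContraction {m : ℕ} {G : Graph (suc m)} {u v : Fin (suc m)} (uv : IsEdge G u v)
                            (sep : Separation G u v) where

  open Contraction G u v uv
  open Separation sep

  pull-push : ∀ X → IsFlow G X → X u v ≡ 0ℚ → ∀ i j → pullFlow (pushFlow X) i j ≡ X i j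
  pull-push X flow@(skew , off-edges) Xuv≡0 i j with adj G i j in ij
  ... | false = sym (off-edges i j ij)
  ... | true  = on-edge i j ij
    where
    M = merge _+_ 0ℚ X
    PX : Flow (suc m)
    PX i j = M (embed (collapse i)) (embed (collapse j))
    PX-skew : Skew PX
    PX-skew i j = merge-skew X skew (embed (collapse i)) (embed (collapse j))
    from-endpoint : ∀ w j → w ≡ u ⊎ w ≡ v → adj G w j ≡ true → j ≢ u → j ≢ v → PX w j ≡ X w j
    from-endpoint w j w∈uv wj j≢u j≢v = begin
      M (embed (collapse w)) (embed (collapse j))
        ≡⟨ cong₂ M (embed-collapse-endpoint w∈uv) (embed-collapse j j≢v) ⟩
      M u j
        ≡⟨ merge-u• _+_ 0ℚ X refl j≢u ⟩
      X u j + X v j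
        ≡⟨ uv-row-sum sep X flow w∈uv wj ⟩
      X w j ∎
      where open ≡-Reasoning
    on-edge : ∀ i j → adj G i j ≡ true → PX i j ≡ X i j
    on-edge i j ij with endpoint i | endpoint j
    ... | is-u refl | is-u refl = contradiction refl (adj⇒≢ G ij)
    ... | is-v refl | is-v refl = contradiction refl (adj⇒≢ G ij)
    ... | is-u refl | is-v refl = trans (merge-uu _+_ 0ℚ X embed-collapse-u embed-collapse-v) (sym Xuv≡0)
    ... | is-v refl | is-u refl =
      trans (merge-uu _+_ 0ℚ X embed-collapse-v embed-collapse-u) (sym (trans (skew v u) (cong -_ Xuv≡0)))
    ... | is-u refl | other j≢u j≢v = from-endpoint u j (inj₁ refl) ij j≢u j≢v
    ... | is-v refl | other j≢u j≢v = from-endpoint v j (inj₂ refl) ij j≢u j≢v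
    ... | other i≢u i≢v | is-u refl =
      skew-swap PX-skew skew (from-endpoint u i (inj₁ refl) (flip-adj G ij) i≢u i≢v)
    ... | other i≢u i≢v | is-v refl =
      skew-swap PX-skew skew (from-endpoint v i (inj₂ refl) (flip-adj G ij) i≢u i≢v)
    ... | other i≢u i≢v | other j≢u j≢v =
      trans (cong₂ M (embed-collapse i i≢v) (embed-collapse j j≢v)) (merge-•• _+_ 0ℚ X i≢u j≢u)

  push-pull : ∀ Y → IsFlow G/uv Y → ∀ a b → pushFlow (pullFlow Y) a b ≡ Y a b
  push-pull Y (skew , off-edges) a b = by-cases a b (embed a ≟ u) (embed b ≟ u)
    where
    M = merge _+_ 0ℚ (pullFlow Y)
    PY-skew : Skew (λ a b → M (embed a) (embed b))
    PY-skew a b = merge-skew (pullFlow Y) (proj₁ (pullFlow-isFlow Y (skew , off-edges))) (embed a) (embed b)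
    merged-row-pull : ∀ a b → embed a ≡ u → embed b ≢ u → M (embed a) (embed b) ≡ Y a b
    merged-row-pull a b au b≢u = begin
      M (embed a) (embed b)
        ≡⟨ merge-u• _+_ 0ℚ (pullFlow Y) au b≢u ⟩
      when (adj G u (embed b)) (Y (collapse u) (collapse (embed b)))
        + when (adj G v (embed b)) (Y (collapse v) (collapse (embed b)))
        ≡⟨ cong₂ (λ p q → when (adj G u (embed b)) (Y p (collapse (embed b)))
                          + when (adj G v (embed b)) (Y q (collapse (embed b))))
                 (trans collapse-u (sym (embed≡u au))) (trans collapse-v (sym (embed≡u au))) ⟩
      when (adj G u (embed b)) (Y a (collapse (embed b))) + when (adj G v (embed b)) (Y a (collapse (embed b)))
        ≡⟨ cong (λ c → when (adj G u (embed b)) (Y a c) + when (adj G v (embed b)) (Y a c)) (collapse-embed b) ⟩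
      when (adj G u (embed b)) (Y a b) + when (adj G v (embed b)) (Y a b)
        ≡⟨ when-either _ _ (Y a b) (λ (ub , vb) → no-common-neighbour sep (embed b) ub vb)
             (λ nonadj → off-edges a b (trans (adj-contract-u• au b≢u) nonadj)) ⟩
      Y a b ∎
      where open ≡-Reasoning
    by-cases : ∀ a b → Dec (embed a ≡ u) → Dec (embed b ≡ u) → M (embed a) (embed b) ≡ Y a b
    by-cases a b (yes au) (yes bu) with embed-injective (trans au (sym bu))
    ... | refl = trans (merge-uu _+_ 0ℚ (pullFlow Y) au bu) (sym (off-edges a a (adj-irrefl G/uv a)))
    by-cases a b (yes au) (no b≢u) = merged-row-pull a b au b≢u
    by-cases a b (no a≢u) (yes bu) = skew-swap PY-skew skew (merged-row-pull b a bu a≢u)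
    by-cases a b (no a≢u) (no b≢u) = begin
      M (embed a) (embed b)
        ≡⟨ merge-•• _+_ 0ℚ (pullFlow Y) a≢u b≢u ⟩
      when (adj G (embed a) (embed b)) (Y (collapse (embed a)) (collapse (embed b)))
        ≡⟨ cong₂ (λ p q → when (adj G (embed a) (embed b)) (Y p q)) (collapse-embed a) (collapse-embed b) ⟩
      when (adj G (embed a) (embed b)) (Y a b)
        ≡⟨ when-≡ _ (Y a b) (λ nonadj → off-edges a b (trans (adj-contract-•• a≢u b≢u) nonadj)) ⟩
      Y a b ∎
      where open ≡-Reasoning

  module _ (X : Flow (suc m)) (flow : IsFlow G X) where

    private
      M = merge _+_ 0ℚ X
      skew = proj₁ flow
      off-edges = proj₂ flow

    divergence-unmerged : DivergenceFree X → ∀ a → embed a ≢ u → sumFin (pushFlow X a) ≡ 0ℚ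
    divergence-unmerged div-free a a≢u = begin
      sumFin (λ b → M i (embed b))
        ≡⟨ sumFin-perturb (X i ∘ embed) (λ b → M i (embed b)) merged (X i v) at-merged elsewhere ⟩
      sumFin (X i ∘ embed) + X i v
        ≡⟨ +-comm _ (X i v) ⟩
      X i v + sumFin (X i ∘ embed)
        ≡⟨ sumFin-punchIn v (X i) ⟨
      sumFin (X i)
        ≡⟨ div-free i ⟩
      0ℚ ∎
      where
      open ≡-Reasoning
      i = embed a
      at-merged : M i (embed merged) ≡ X i (embed merged) + X i v
      at-merged = begin
        M i (embed merged)          ≡⟨ merge-•u _+_ 0ℚ X a≢u embed-merged ⟩
        X i u + X i v               ≡⟨ cong (λ w → X i w + X i v) embed-merged ⟨
        X i (embed merged) + X i v  ∎
      elsewhere : ∀ b → b ≢ merged → M i (embed b) ≡ X i (embed b)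
      elsewhere b b≢merged = merge-•• _+_ 0ℚ X a≢u (b≢merged ∘ embed≡u)

    divergence-merged : DivergenceFree X → ∀ a → embed a ≡ u → sumFin (pushFlow X a) ≡ 0ℚ
    divergence-merged div-free a au = begin
      sumFin (λ b → M (embed a) (embed b))
        ≡⟨ sumFin-perturb (λ b → X u (embed b) + X v (embed b)) (λ b → M (embed a) (embed b)) merged
                          (- (X u u + X v u)) at-merged elsewhere ⟩
      sumFin (λ b → X u (embed b) + X v (embed b)) + - (X u u + X v u)
        ≡⟨ cong (_+ - (X u u + X v u)) (sum-+ sumFin-summation (X u ∘ embed) (X v ∘ embed)) ⟩
      P + Q + - (X u u + X v u)
        ≡⟨ cong₂ (λ s t → P + Q + - (s + t)) (off-edges u u (adj-irrefl G u)) (skew v u) ⟩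
      P + Q + - (0ℚ + - X u v)
        ≡⟨ solve 4 (λ p q x y → p :+ q :+ :- (con 0ℚ :+ :- x) := (x :+ p) :+ (y :+ q) :+ :- y) refl
                   P Q (X u v) (X v v) ⟩
      (X u v + P) + (X v v + Q) + - X v v
        ≡⟨ cong₂ (λ s t → s + t + - X v v) (trans (sym (sumFin-punchIn v (X u))) (div-free u))
                                           (trans (sym (sumFin-punchIn v (X v))) (div-free v)) ⟩
      0ℚ + 0ℚ + - X v v
        ≡⟨ cong (λ s → 0ℚ + 0ℚ + - s) (off-edges v v (adj-irrefl G v)) ⟩
      0ℚ ∎
      where
      open ≡-Reasoning
      P = sumFin (X u ∘ embed)
      Q = sumFin (X v ∘ embed)
      at-merged : M (embed a) (embed merged) ≡ (X u (embed merged) + X v (embed merged)) + - (X u u + X v u)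
      at-merged = begin
        M (embed a) (embed merged)   ≡⟨ merge-uu _+_ 0ℚ X au embed-merged ⟩
        0ℚ                           ≡⟨ +-inverseʳ (X u u + X v u) ⟨
        (X u u + X v u) + - (X u u + X v u)
                                     ≡⟨ cong (λ w → (X u w + X v w) + - (X u u + X v u)) embed-merged ⟨
        (X u (embed merged) + X v (embed merged)) + - (X u u + X v u) ∎
      elsewhere : ∀ b → b ≢ merged → M (embed a) (embed b) ≡ X u (embed b) + X v (embed b)
      elsewhere b b≢merged = merge-u• _+_ 0ℚ X au (b≢merged ∘ embed≡u)

    pushFlow-divergenceFree : DivergenceFree X → DivergenceFree (pushFlow X)
    pushFlow-divergenceFree div-free a = by-cases (embed a ≟ u)
      where
      by-cases : Dec (embed a ≡ u) → sumFin (pushFlow X a) ≡ 0ℚ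
      by-cases (no a≢u) = divergence-unmerged div-free a a≢u
      by-cases (yes au) = divergence-merged div-free a au

    curl-through-merged : CurlFree G X → ∀ {a b c} → embed a ≡ u → embed b ≢ u → embed c ≢ u →
      adj G/uv a b ≡ true → adj G/uv b c ≡ true → adj G/uv a c ≡ true → Cycle (pushFlow X) a b c
    curl-through-merged curl-free {a} {b} {c} au b≢u c≢u ab bc ac
      with uv-neighbour sep (trans (sym (adj-contract-u• au b≢u)) ab)
    ... | w , w∈uv , wj = begin
      M (embed a) j + M j k + M k (embed a)
        ≡⟨ cong₂ _+_ (cong₂ _+_ (merge-u• _+_ 0ℚ X au b≢u) (merge-•• _+_ 0ℚ X b≢u c≢u))
                     (merge-•u _+_ 0ℚ X c≢u au) ⟩
      (X u j + X v j) + X j k + (X k u + X k v)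
        ≡⟨ cong₂ _+_ (cong (_+ X j k) (uv-row-sum sep X flow w∈uv wj)) (uv-column-sum sep X flow w∈uv wk) ⟩
      X w j + X j k + X k w
        ≡⟨ curl-free w j k wj jk wk ⟩
      0ℚ ∎
      where
      open ≡-Reasoning
      j = embed b
      k = embed c
      jk = trans (sym (adj-contract-•• b≢u c≢u)) bc
      wk = same-uv-neighbour sep w∈uv b≢u (embed≢v b) c≢u (embed≢v c) wj jk
                             (trans (sym (adj-contract-u• au c≢u)) ac)

    pushFlow-curlFree : CurlFree G X → CurlFree G/uv (pushFlow X)
    pushFlow-curlFree curl-free a b c ab bc ac = by-cases (embed a ≟ u) (embed b ≟ u) (embed c ≟ u)
      where
      PX = pushFlow X
      distinct : ∀ {p q} → adj G/uv p q ≡ true → embed p ≡ u → embed q ≡ u → ⊥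
      distinct pq pu qu = adj⇒≢ G/uv pq (embed-injective (trans pu (sym qu)))
      unmerged : ∀ {p q} → embed p ≢ u → embed q ≢ u → adj G/uv p q ≡ true → adj G (embed p) (embed q) ≡ true
      unmerged p≢u q≢u pq = trans (sym (adj-contract-•• p≢u q≢u)) pq
      by-cases : Dec (embed a ≡ u) → Dec (embed b ≡ u) → Dec (embed c ≡ u) → Cycle PX a b c
      by-cases (yes au) (yes bu) _        = contradiction bu (distinct ab au)
      by-cases (yes au) (no _)   (yes cu) = contradiction cu (distinct ac au)
      by-cases (no _)   (yes bu) (yes cu) = contradiction cu (distinct bc bu)
      by-cases (yes au) (no b≢u) (no c≢u) = curl-through-merged curl-free au b≢u c≢u ab bc ac
      by-cases (no a≢u) (yes bu) (no c≢u) = cycle-rotate PX (cycle-rotate PX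
        (curl-through-merged curl-free bu c≢u a≢u bc (flip-adj G/uv ac) (flip-adj G/uv ab)))
      by-cases (no a≢u) (no b≢u) (yes cu) = cycle-rotate PX
        (curl-through-merged curl-free cu a≢u b≢u (flip-adj G/uv ac) ab (flip-adj G/uv bc))
      by-cases (no a≢u) (no b≢u) (no c≢u) =
        trans (cong₂ _+_ (cong₂ _+_ (merge-•• _+_ 0ℚ X a≢u b≢u) (merge-•• _+_ 0ℚ X b≢u c≢u))
                         (merge-•• _+_ 0ℚ X c≢u a≢u))
              (curl-free (embed a) (embed b) (embed c)
                         (unmerged a≢u b≢u ab) (unmerged b≢u c≢u bc) (unmerged a≢u c≢u ac))

    pushFlow-harmonic : IsHarmonic G X → IsHarmonic G/uv (pushFlow X)
    pushFlow-harmonic (div-free , curl-free) = pushFlow-divergenceFree div-free , pushFlow-curlFree curl-free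

  module _ (Y : Flow m) (flow : IsFlow G/uv Y) where

    private
      skew = proj₁ flow
      off-edges = proj₂ flow

      avoids-uv : ∀ {a b c} → adj G a c ≡ true → adj G b c ≡ true → ¬ (a ≡ u × b ≡ v)
      avoids-uv {c = c} ac bc (refl , refl) = no-common-neighbour sep c ac bc

      adj-collapse-triangle : ∀ {a b c} → adj G a b ≡ true → adj G a c ≡ true → adj G b c ≡ true →
        adj G/uv (collapse a) (collapse b) ≡ true
      adj-collapse-triangle {a} {b} ab ac bc = adj-collapse a b ab (avoids-uv ac bc) (avoids-uv bc ac ∘ swap)

    pullFlow-curlFree : CurlFree G/uv Y → CurlFree G (pullFlow Y)
    pullFlow-curlFree curl-free a b c ab bc ac = begin
      pullFlow Y a b + pullFlow Y b c + pullFlow Y c a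
        ≡⟨ cong₂ _+_ (cong₂ _+_ (cong (λ p → when p (Y (collapse a) (collapse b))) ab)
                                (cong (λ p → when p (Y (collapse b) (collapse c))) bc))
                     (cong (λ p → when p (Y (collapse c) (collapse a))) (flip-adj G ac)) ⟩
      Y (collapse a) (collapse b) + Y (collapse b) (collapse c) + Y (collapse c) (collapse a)
        ≡⟨ curl-free (collapse a) (collapse b) (collapse c)
                     (adj-collapse-triangle ab ac bc)
                     (adj-collapse-triangle bc (flip-adj G ab) (flip-adj G ac))
                     (adj-collapse-triangle ac ab (flip-adj G bc)) ⟩
      0ℚ ∎
      where open ≡-Reasoning

    private
      ΣFin = sumFin-summation {m}

      Y-merged-merged : Y merged merged ≡ 0ℚ
      Y-merged-merged = off-edges merged merged (adj-irrefl G/uv merged)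

      u-part v-part : Fin m → ℚ
      u-part b = when (adj G u (embed b)) (Y merged b)
      v-part b = when (adj G v (embed b)) (Y merged b)

      strictly-u-side : Fin m → Bool
      strictly-u-side b with embed b ≟ u
      ... | yes _ = false
      ... | no _  = side (embed b)

      strictly-u-side⇒ : ∀ b → strictly-u-side b ≡ true → side (embed b) ≡ true × embed b ≢ u
      strictly-u-side⇒ b sb with embed b ≟ u
      ... | no b≢u = sb , b≢u

      strictly-u-side-intro : ∀ b → side (embed b) ≡ true → embed b ≢ u → strictly-u-side b ≡ true
      strictly-u-side-intro b sb b≢u with embed b ≟ u
      ... | yes bu = contradiction bu b≢u
      ... | no _   = sb

      strictly-u-side-merged : strictly-u-side merged ≡ false
      strictly-u-side-merged with embed merged ≟ u
      ... | yes _ = refl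
      ... | no merged≢u = contradiction embed-merged merged≢u

    split-merged-row : ∀ b → Y merged b ≡ u-part b + v-part b
    split-merged-row b with embed b ≟ u
    ... | yes bu rewrite embed≡u bu | Y-merged-merged =
      sym (cong₂ _+_ (when-0 (adj G u (embed merged))) (when-0 (adj G v (embed merged))))
    ... | no b≢u = sym (when-either _ _ (Y merged b)
      (λ (ub , vb) → no-common-neighbour sep (embed b) ub vb)
      (λ nonadj → off-edges merged b (trans (adj-contract-u• embed-merged b≢u) nonadj)))

    -- In G/uv the vertices strictly on u's side have neighbours only among themselves and the merged vertex.
    flow-into-merged≡0 : DivergenceFree Y → sumFin (λ b → when (strictly-u-side b) (Y b merged)) ≡ 0ℚ
    flow-into-merged≡0 div-free = begin
      sumFin (λ b → when (T b) (Y b merged))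
        ≡⟨ sum-cong ΣFin (λ b → trans (sumFin-delta (across b) merged (only-into-merged b))
                                      (cong (λ t → when (T b) (when (not t) (Y b merged))) strictly-u-side-merged)) ⟨
      sumFin (λ b → sumFin (across b))
        ≡⟨ boundary-flow T Y skew ⟨
      sumFin (λ b → when (T b) (sumFin (Y b)))
        ≡⟨ sum-≡0 ΣFin (λ b → trans (cong (when (T b)) (div-free b)) (when-0 (T b))) ⟩
      0ℚ ∎
      where
      open ≡-Reasoning
      T = strictly-u-side
      across : Flow m
      across b c = when (T b) (when (not (T c)) (Y b c))
      only-into-merged : ∀ b c → c ≢ merged → across b c ≡ 0ℚ
      only-into-merged b c c≢merged with T b in tb | T c in tc
      ... | false | _    = refl
      ... | true  | true = refl
      ... | true  | false with adj G/uv b c in bc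
      ...   | false = off-edges b c bc
      ...   | true  = contradiction (strictly-u-side-intro c (side-closed sep (embed b) (embed c) bc′ b≢u sb) c≢u)
                                    (≡false⇒≢true tc)
        where
        sb = proj₁ (strictly-u-side⇒ b tb)
        b≢u = proj₂ (strictly-u-side⇒ b tb)
        c≢u = c≢merged ∘ embed≡u
        bc′ = trans (sym (adj-contract-•• b≢u c≢u)) bc

    u-part≡-flow-into-merged : ∀ b → u-part b ≡ - when (strictly-u-side b) (Y b merged)
    u-part≡-flow-into-merged b with adj G u (embed b) in ub
    ... | true  = trans (skew merged b) (cong (λ t → - when t (Y b merged)) (sym strictly))
      where
      strictly = strictly-u-side-intro b (u-neighbour-side sep (embed b) ub (embed≢v b)) (adj⇒≢ G ub ∘ sym)
    ... | false with strictly-u-side b in tb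
    ...   | false = refl
    ...   | true  = sym (cong -_ (off-edges b merged (trans (adj-sym G/uv b merged)
                      (trans (adj-contract-u• embed-merged b≢u) (cong₂ _∨_ ub vb)))))
      where
      sb = proj₁ (strictly-u-side⇒ b tb)
      b≢u = proj₂ (strictly-u-side⇒ b tb)
      vb : adj G v (embed b) ≡ false
      vb = Bool.¬-not λ vb → ≡false⇒≢true (v-neighbour-side sep (embed b) vb b≢u) sb

    u-side-flow≡0 : DivergenceFree Y → sumFin u-part ≡ 0ℚ
    u-side-flow≡0 div-free = begin
      sumFin u-part
        ≡⟨ sum-cong ΣFin u-part≡-flow-into-merged ⟩
      sumFin (λ b → - when (strictly-u-side b) (Y b merged))
        ≡⟨ sum-neg ΣFin (λ b → when (strictly-u-side b) (Y b merged)) ⟩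
      - sumFin (λ b → when (strictly-u-side b) (Y b merged))
        ≡⟨ cong -_ (flow-into-merged≡0 div-free) ⟩
      0ℚ ∎
      where open ≡-Reasoning

    v-side-flow≡0 : DivergenceFree Y → sumFin v-part ≡ 0ℚ
    v-side-flow≡0 div-free = begin
      sumFin v-part                          ≡⟨ +-identityˡ (sumFin v-part) ⟨
      0ℚ + sumFin v-part                     ≡⟨ cong (_+ sumFin v-part) (u-side-flow≡0 div-free) ⟨
      sumFin u-part + sumFin v-part          ≡⟨ sum-+ ΣFin u-part v-part ⟨
      sumFin (λ b → u-part b + v-part b)     ≡⟨ sum-cong ΣFin split-merged-row ⟨
      sumFin (Y merged)                      ≡⟨ div-free merged ⟩
      0ℚ ∎
      where open ≡-Reasoning

    private
      pulled-row : Fin (suc m) → Fin m → ℚ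
      pulled-row w b = when (adj G w (embed b)) (Y (collapse w) b)

    sumFin-pullFlow : ∀ w → sumFin (pullFlow Y w) ≡ pullFlow Y w v + sumFin (pulled-row w)
    sumFin-pullFlow w = trans (sumFin-punchIn v (pullFlow Y w)) (cong (pullFlow Y w v +_) (sum-cong ΣFin (λ b →
      cong (λ c → when (adj G w (embed b)) (Y (collapse w) c)) (collapse-embed b))))

    pullFlow-divergence-unmerged : DivergenceFree Y → ∀ w → w ≢ u → w ≢ v → sumFin (pullFlow Y w) ≡ 0ℚ
    pullFlow-divergence-unmerged div-free w w≢u w≢v = begin
      sumFin (pullFlow Y w)
        ≡⟨ sumFin-pullFlow w ⟩
      pullFlow Y w v + sumFin (pulled-row w)
        ≡⟨ cong (λ q → when (adj G w v) (Y c q) + sumFin (pulled-row w)) collapse-v ⟩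
      when (adj G w v) (Y c merged) + sumFin (pulled-row w)
        ≡⟨ +-comm _ (sumFin (pulled-row w)) ⟩
      sumFin (pulled-row w) + when (adj G w v) (Y c merged)
        ≡⟨ sumFin-perturb (pulled-row w) (Y c) merged (when (adj G w v) (Y c merged)) at-merged elsewhere ⟨
      sumFin (Y c)
        ≡⟨ div-free c ⟩
      0ℚ ∎
      where
      open ≡-Reasoning
      c = collapse w
      ĉ≡w : embed c ≡ w
      ĉ≡w = embed-collapse w w≢v
      ĉ≢u : embed c ≢ u
      ĉ≢u = w≢u ∘ trans (sym ĉ≡w)
      at-merged : Y c merged ≡ pulled-row w merged + when (adj G w v) (Y c merged)
      at-merged = sym (trans (cong (λ x → when (adj G w x) (Y c merged) + when (adj G w v) (Y c merged)) embed-merged)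
        (when-either _ _ (Y c merged)
          (λ (wu , wv) → no-common-neighbour sep w (flip-adj G wu) (flip-adj G wv))
          (λ nonadj → off-edges c merged
            (trans (adj-contract-•u ĉ≢u embed-merged)
                   (trans (cong (λ x → adj G x u ∨ adj G x v) ĉ≡w) nonadj)))))
      elsewhere : ∀ b → b ≢ merged → Y c b ≡ pulled-row w b
      elsewhere b b≢merged = sym (when-≡ _ (Y c b) (λ nonadj → off-edges c b
        (trans (adj-contract-•• ĉ≢u (b≢merged ∘ embed≡u))
               (trans (cong (λ x → adj G x (embed b)) ĉ≡w) nonadj))))

    pullFlow-divergenceFree : DivergenceFree Y → DivergenceFree (pullFlow Y)
    pullFlow-divergenceFree div-free w with endpoint w
    ... | is-u refl = begin
      sumFin (pullFlow Y u)
        ≡⟨ sumFin-pullFlow u ⟩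
      when (adj G u v) (Y (collapse u) (collapse v)) + sumFin (pulled-row u)
        ≡⟨ cong₂ (λ p q → when (adj G u v) (Y p q) + sumFin (pulled-row u)) collapse-u collapse-v ⟩
      when (adj G u v) (Y merged merged) + sumFin (pulled-row u)
        ≡⟨ cong₂ _+_ (trans (cong (when (adj G u v)) Y-merged-merged) (when-0 (adj G u v)))
                     (trans (sum-cong ΣFin (λ b → cong (λ p → when (adj G u (embed b)) (Y p b)) collapse-u))
                            (u-side-flow≡0 div-free)) ⟩
      0ℚ + 0ℚ
        ≡⟨ +-identityʳ 0ℚ ⟩
      0ℚ ∎
      where open ≡-Reasoning
    ... | is-v refl = begin
      sumFin (pullFlow Y v)
        ≡⟨ sumFin-pullFlow v ⟩
      when (adj G v v) (Y (collapse v) (collapse v)) + sumFin (pulled-row v)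
        ≡⟨ cong₂ _+_ (cong (λ p → when p (Y (collapse v) (collapse v))) (adj-irrefl G v))
                     (trans (sum-cong ΣFin (λ b → cong (λ p → when (adj G v (embed b)) (Y p b)) collapse-v))
                            (v-side-flow≡0 div-free)) ⟩
      0ℚ + 0ℚ
        ≡⟨ +-identityʳ 0ℚ ⟩
      0ℚ ∎
      where open ≡-Reasoning
    ... | other w≢u w≢v = pullFlow-divergence-unmerged div-free w w≢u w≢v

    pullFlow-harmonic : IsHarmonic G/uv Y → IsHarmonic G (pullFlow Y)
    pullFlow-harmonic (div-free , curl-free) = pullFlow-divergenceFree div-free , pullFlow-curlFree curl-free

record KernelIso {n₁ n₂ : ℕ} (G₁ : Graph n₁) (G₂ : Graph n₂) : Set where
  field
    to          : (Edge G₁ → ℚ) → Edge G₂ → ℚ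
    from        : (Edge G₂ → ℚ) → Edge G₁ → ℚ
    to-linear   : IsLinear to
    from-linear : IsLinear from
    to-kernel   : ∀ x → InKernel G₁ x → InKernel G₂ (to x)
    from-kernel : ∀ y → InKernel G₂ y → InKernel G₁ (from y)
    from-to     : ∀ x → InKernel G₁ x → ∀ e → from (to x) e ≡ x e
    to-from     : ∀ y → InKernel G₂ y → ∀ e → to (from y) e ≡ y e

KernelIso-sym : ∀ {n₁ n₂} {G₁ : Graph n₁} {G₂ : Graph n₂} → KernelIso G₁ G₂ → KernelIso G₂ G₁
KernelIso-sym iso = record
  { to = from ; from = to ; to-linear = from-linear ; from-linear = to-linear
  ; to-kernel = from-kernel ; from-kernel = to-kernel ; from-to = to-from ; to-from = from-to }
  where open KernelIso iso

independent-transfer : ∀ {n₁ n₂} {G₁ : Graph n₁} {G₂ : Graph n₂} (iso : KernelIso G₁ G₂) →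
  ∀ {k} (w : Fin k → Edge G₁ → ℚ) → (∀ l → InKernel G₁ (w l)) → LinIndep G₁ w →
  LinIndep G₂ (λ l → KernelIso.to iso (w l))
independent-transfer iso w w-kernel w-indep c Σc·to-w≡0 = w-indep c λ e → begin
  sumFin (λ l → c l * w l e)
    ≡⟨ sum-cong sumFin-summation (λ l → cong (c l *_) (from-to (w l) (w-kernel l) e)) ⟨
  sumFin (λ l → c l * from (to (w l)) e)
    ≡⟨ pointwise-linear from-linear e c (λ l → to (w l)) ⟩
  from (λ f → sumFin (λ l → c l * to (w l) f)) e
    ≡⟨ maps-zero from-linear Σc·to-w≡0 e ⟩
  0ℚ ∎
  where
  open ≡-Reasoning
  open KernelIso iso

EtaH-transfer : ∀ {n₁ n₂} {G₁ : Graph n₁} {G₂ : Graph n₂} → KernelIso G₁ G₂ →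
  ∀ k → EtaH G₁ k → EtaH G₂ k
EtaH-transfer iso k ((w , w-kernel , w-indep) , maximal) =
  ((λ l → to (w l)) , (λ l → to-kernel (w l) (w-kernel l)) , independent-transfer iso w w-kernel w-indep) ,
  (λ w′ w′-kernel w′-indep → maximal (λ l → from (w′ l)) (λ l → from-kernel (w′ l) (w′-kernel l))
                               (independent-transfer (KernelIso-sym iso) w′ w′-kernel w′-indep))
  where open KernelIso iso

module _ {m : ℕ} {G : Graph (suc m)} {u v : Fin (suc m)} (uv : IsEdge G u v) (sep : Separation G u v)
  where

  open Contraction G u v uv
  open SeparatedContraction uv sep

  toContraction : (Edge G → ℚ) → Edge G/uv → ℚ
  toContraction x = restrict G/uv (pushFlow (flowOf G x))

  fromContraction : (Edge G/uv → ℚ) → Edge G → ℚ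
  fromContraction y = restrict G (pullFlow (flowOf G/uv y))

  toContraction-kernel : ∀ x → InKernel G x → InKernel G/uv (toContraction x)
  toContraction-kernel x x∈ker = harmonic⇒kernel G/uv (toContraction x)
    (IsHarmonic-cong G/uv (λ a b → sym (flowOf-restrict G/uv (pushFlow X) (pushFlow-isFlow X X-flow) a b))
                          (pushFlow-harmonic X X-flow (kernel⇒harmonic G x x∈ker)))
    where
    X = flowOf G x
    X-flow = flowOf-isFlow G x

  fromContraction-kernel : ∀ y → InKernel G/uv y → InKernel G (fromContraction y)
  fromContraction-kernel y y∈ker = harmonic⇒kernel G (fromContraction y)
    (IsHarmonic-cong G (λ i j → sym (flowOf-restrict G (pullFlow Y) (pullFlow-isFlow Y Y-flow) i j))
                       (pullFlow-harmonic Y Y-flow (kernel⇒harmonic G/uv y y∈ker)))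
    where
    Y = flowOf G/uv y
    Y-flow = flowOf-isFlow G/uv y

  from-toContraction : ∀ x → InKernel G x → ∀ e → fromContraction (toContraction x) e ≡ x e
  from-toContraction x x∈ker e@((i , j) , _) = begin
    pullFlow (flowOf G/uv (restrict G/uv (pushFlow X))) i j
      ≡⟨ pointwise-cong pullFlow-linear
           (λ (a , b) → flowOf-restrict G/uv (pushFlow X) (pushFlow-isFlow X X-flow) a b) (i , j) ⟩
    pullFlow (pushFlow X) i j
      ≡⟨ pull-push X X-flow (separating-edge-flow≡0 sep X X-flow (proj₁ (kernel⇒harmonic G x x∈ker))) i j ⟩
    X i j
      ≡⟨ restrict-flowOf G x e ⟩
    x e ∎
    where
    open ≡-Reasoning
    X = flowOf G x
    X-flow = flowOf-isFlow G x

  to-fromContraction : ∀ y e → toContraction (fromContraction y) e ≡ y e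
  to-fromContraction y e@((a , b) , _) = begin
    pushFlow (flowOf G (restrict G (pullFlow Y))) a b
      ≡⟨ pointwise-cong pushFlow-linear
           (λ (i , j) → flowOf-restrict G (pullFlow Y) (pullFlow-isFlow Y Y-flow) i j) (a , b) ⟩
    pushFlow (pullFlow Y) a b
      ≡⟨ push-pull Y Y-flow a b ⟩
    Y a b
      ≡⟨ restrict-flowOf G/uv y e ⟩
    y e ∎
    where
    open ≡-Reasoning
    Y = flowOf G/uv y
    Y-flow = flowOf-isFlow G/uv y

  contraction-kernelIso : KernelIso G G/uv
  contraction-kernelIso = record
    { to = toContraction ; from = fromContraction
    ; to-linear = ∘-linear (restrict-linear G/uv) (∘-linear pushFlow-linear (flowOf-linear G))
    ; from-linear = ∘-linear (restrict-linear G) (∘-linear pullFlow-linear (flowOf-linear G/uv))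
    ; to-kernel = toContraction-kernel ; from-kernel = fromContraction-kernel
    ; from-to = from-toContraction ; to-from = λ y _ → to-fromContraction y }

corollary3p16 : ∀ {m} (G : Graph (suc m)) (e : Edge G) → IsCutEdge G e →
    ∀ (k : ℕ) → EtaH G k ⇔ EtaH (contract G e) k
corollary3p16 G ((u , v) , uv) cut k =
  mk⇔ (EtaH-transfer iso k) (EtaH-transfer (KernelIso-sym iso) k)
  where
  iso = contraction-kernelIso uv (cutEdge-separation G u v uv cut)
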